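{- Let $G$ be a finite simple graph with no isolated vertices that is $C_6$-free and not isomorphic to any of the following graphs. Each is built on a $5$-cycle with vertices $r,s,t,u,v$ and edges $rs,st,tu,uv,vr$, together with an independent set of additional vertices whose neighbourhoods (all contained in $\{r,s,t,u,v\}$) are prescribed: (1) one vertex with neighbourhood $\{r,t,u\}$ and one with neighbourhood $\{s,t,u,v\}$; (2) for any $k\ge 0$: one vertex with neighbourhood $\{r,t,u\}$, one with $\{s,u,v\}$, and $k$ vertices with $\{r,s,u\}$; (3) for any $k\ge 0$: one vertex with neighbourhood $\{r,s,t,u\}$, one with $\{s,t,u,v\}$, and $k$ vertices with $\{r,t,v\}$; (4) for any $a,b,c\ge 0$: $a$ vertices with neighbourhood $\{r,t\}$, $b$ with $\{r,u\}$, and $c$ with $\{r,t,u\}$; (5) for any $a,b,c,d\ge 0$: $a$ vertices with neighbourhood $\{r,t\}$, $b$ with $\{r,t,u\}$, $c$ with $\{r,t,v\}$, and $d$ with $\{r,t,u,v\}$; (6) for any $a,b,c,d,f\ge 0$: $a$ vertices with neighbourhood $\{r,t,u\}$, $b$ with $\{r,t,v\}$, $c$ with $\{r,s,t,u\}$, $d$ with $\{r,t,u,v\}$, and $f$ with $\{r,s,t,u,v\}$. Then $G$ is $C_5$-free if and only if $G/e$ is $C_5$-free for every edge $e\in E(G)$.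
   Context: All graphs are finite and simple. $C_n$ is the cycle on $n$ vertices. A graph is $H$-free if it has no induced subgraph isomorphic to $H$. For an edge $e=uv$ of $G$, the contraction $G/e$ is obtained from $G$ by deleting $u$ and $v$ and adding a new vertex adjacent to every vertex of $(N(u)\cup N(v))\setminus\{u,v\}$. -}

module Defs where

open import Data.Nat using (ℕ; zero; suc; _%_)
open import Data.Nat.Base using (_≡ᵇ_)
open import Data.Bool using (Bool; true; false; _∨_; if_then_else_)
open import Data.Fin using (Fin; toℕ; _≟_)
open import Data.Fin.Patterns using (0F; 1F; 2F; 3F; 4F)
open import Data.Sum using (_⊎_; inj₁; inj₂)
open import Data.Product using (Σ; ∃; _,_)
open import Data.List using (List; []; _∷_; _++_; replicate; length; lookup)
open import Relation.Nullary using (¬_)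
open import Relation.Nullary.Decidable using (⌊_⌋)
open import Relation.Binary.PropositionalEquality using (_≡_; _≢_)
open import Function.Bundles using (_↔_; Inverse)

record Graph (n : ℕ) : Set where
  field
    adj   : Fin n → Fin n → Bool
    sym   : ∀ x y → adj x y ≡ adj y x
    irrefl : ∀ x → adj x x ≡ false
open Graph public

cycleAdj : ∀ {m} → Fin (suc m) → Fin (suc m) → Bool
cycleAdj {m} i j =
  ((suc (toℕ i) % suc m) ≡ᵇ toℕ j) ∨ ((suc (toℕ j) % suc m) ≡ᵇ toℕ i)

HasInducedCycle : (m : ℕ) {V : Set} → (V → V → Bool) → Set
HasInducedCycle m {V} adj =
  Σ (Fin (suc m) → V) λ f →
    (∀ i j → f i ≡ f j → i ≡ j) × (∀ i j → adj (f i) (f j) ≡ cycleAdj i j)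
  where open import Data.Product using (_×_)

C5Free : {V : Set} → (V → V → Bool) → Set
C5Free adj = ¬ HasInducedCycle 4 adj

C6Free : {V : Set} → (V → V → Bool) → Set
C6Free adj = ¬ HasInducedCycle 5 adj

NoIsolated : ∀ {n} → Graph n → Set
NoIsolated G = ∀ x → ∃ λ y → adj G x y ≡ true

-- Vertex set: all vertices except v;
-- the vertex u plays the role of the new merged vertex, adjacent to every
-- vertex of (N(u) ∪ N(v)) ∖ {u,v}.
ContractV : ∀ {n} → Fin n → Set
ContractV {n} v = Σ (Fin n) λ w → w ≢ v

contract : ∀ {n} → Graph n → (u v : Fin n) → ContractV v → ContractV v → Bool
contract G u v (x , _) (y , _) =
  if ⌊ x ≟ y ⌋ then false
  else if ⌊ x ≟ u ⌋ then (adj G u y ∨ adj G v y)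
  else if ⌊ y ≟ u ⌋ then (adj G x u ∨ adj G x v)
  else adj G x y

-- Exceptional graphs: a 5-cycle r s t u v (= 0,1,2,3,4, edges rs, st, tu,
-- uv, vr) plus an independent set of extra vertices, one per entry of a
-- list of prescribed neighbourhoods (subsets of the 5-cycle).

Nbhd : Set
Nbhd = Fin 5 → Bool

nb : Bool → Bool → Bool → Bool → Bool → Nbhd
nb r s t u v 0F = r
nb r s t u v 1F = s
nb r s t u v 2F = t
nb r s t u v 3F = u
nb r s t u v 4F = v

ExcV : List Nbhd → Set
ExcV L = Fin 5 ⊎ Fin (length L)

excAdj : (L : List Nbhd) → ExcV L → ExcV L → Bool
excAdj L (inj₁ i) (inj₁ j) = cycleAdj i j
excAdj L (inj₁ i) (inj₂ k) = lookup L k i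
excAdj L (inj₂ k) (inj₁ i) = lookup L k i
excAdj L (inj₂ k) (inj₂ l) = false

N-rt N-ru N-rtu N-suv N-rsu N-rtv N-rsTu N-stuv N-rtuv N-rstuv : Nbhd
N-rt    = nb true  false true  false false
N-ru    = nb true  false false true  false
N-rtu   = nb true  false true  true  false
N-suv   = nb false true  false true  true
N-rsu   = nb true  true  false true  false
N-rtv   = nb true  false true  false true
N-rsTu  = nb true  true  true  true  false
N-stuv  = nb false true  true  true  true
N-rtuv  = nb true  false true  true  true
N-rstuv = nb true  true  true  true  true

data Exceptional : List Nbhd → Set where
  ex1 : Exceptional (N-rtu ∷ N-stuv ∷ [])
  ex2 : ∀ k → Exceptional (N-rtu ∷ N-suv ∷ replicate k N-rsu)
  ex3 : ∀ k → Exceptional (N-rsTu ∷ N-stuv ∷ replicate k N-rtv)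
  ex4 : ∀ a b c → Exceptional (replicate a N-rt ++ replicate b N-ru ++ replicate c N-rtu)
  ex5 : ∀ a b c d → Exceptional
          (replicate a N-rt ++ replicate b N-rtu ++ replicate c N-rtv ++ replicate d N-rtuv)
  ex6 : ∀ a b c d f → Exceptional
          (replicate a N-rtu ++ replicate b N-rtv ++ replicate c N-rsTu
            ++ replicate d N-rtuv ++ replicate f N-rstuv)

IsoToExc : ∀ {n} → Graph n → List Nbhd → Set
IsoToExc {n} G L =
  Σ (Fin n ↔ ExcV L) λ φ →
    ∀ x y → adj G x y ≡ excAdj L (Inverse.to φ x) (Inverse.to φ y)

module Submission where

-- Contracting an edge uv of a C₅- and C₆-free graph can only create an induced
-- C₅ through the merged vertex. Its other four vertices form an induced path P
-- of G; each end of P is adjacent to u or to v, and neither u nor v sees the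
-- middle of P. So u or v closes P into a C₅, or u, v and P form a C₆.
--
-- Conversely, let f be an induced C₅ of G such that no contraction has an
-- induced C₅. Contracting an edge between two vertices off f would keep f, so
-- these vertices are independent, and G is determined by how many of them have
-- each of the 32 possible neighbourhoods on f. Configurations of at most three
-- off-cycle vertices in which some contraction keeps an induced C₅ are listed
-- with explicit witnesses; none may occur in G. As they involve at most two
-- vertices of each kind, the multiplicities only matter up to 2, and a search
-- over these capped multiplicities shows that every profile avoiding the list
-- is, up to a symmetry of the cycle, one of the families (1)–(6). Reading off
-- the off-cycle vertices by neighbourhood then gives an isomorphism with the
-- exceptional graph. Vertices with no neighbour on f would be isolated.

open import Defs renaming (sym to adj-sym; irrefl to adj-irrefl)
open import Data.Nat
  using (ℕ; zero; suc; _+_; _*_; _%_; _/_; _^_; _⊓_; _≡ᵇ_; _≤ᵇ_; _≤_; _<_; z≤n; s≤s; s≤s⁻¹)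
  renaming (_≟_ to _≟ℕ_)
open import Data.Nat.Properties
  using (+-identityʳ; +-suc; *-comm; 1+n≢0; ≡ᵇ⇒≡; ≡⇒≡ᵇ; ≤ᵇ⇒≤; ≤-refl; ≤-trans; ≤-reflexive; +-monoˡ-≤; *-monoˡ-≤;
         m⊓n≤m; m⊓n≤n)
open import Data.Nat.DivMod using (_mod_; [m+kn]%n≡m%n; +-distrib-/-∣ʳ; m*n/n≡m)
open import Data.Nat.Divisibility using (divides)
open import Data.Bool using (Bool; true; false; T; _∧_; _∨_; if_then_else_)
import Data.Bool.Properties as Bool
open import Data.Bool.Properties using (T-≡; T-∧; T-∨)
open import Data.Bool.ListAction using (all; any)
open import Data.Fin using (Fin; zero; suc; toℕ; _≟_; cast)
open import Data.Fin.Patterns using (0F; 1F; 2F; 3F; 4F)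
open import Data.Fin.Properties using (all?; any?; cast-involutive; 0≢1+n)
open import Data.Vec as Vec using (Vec; []; _∷_)
open import Data.Vec.Functional using () renaming (_∷_ to _◂_)
open import Data.Product using (Σ; ∃; _,_; _×_; proj₁; proj₂; uncurry)
open import Data.Sum using (inj₁; inj₂)
open import Data.Sum.Properties using (≡-dec)
open import Data.Empty using (⊥; ⊥-elim)
open import Data.List using (List; []; _∷_; _++_; length; lookup; map; filter; replicate; applyUpTo; allFin)
open import Data.List.Properties using (length-map; length-applyUpTo; ++-assoc; ++-identityʳ)
open import Data.List.Relation.Unary.All as All using (All; []; _∷_)
open import Data.List.Relation.Unary.All.Properties using (applyUpTo⁺₂)
open import Data.List.Relation.Unary.Any as Any using (Any; here; there)
open import Data.List.Relation.Unary.Any.Properties using (lookup-index; any⁻)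
open import Data.List.Relation.Unary.AllPairs as AllPairs using (_∷_)
open import Data.List.Relation.Unary.Unique.Propositional using (Unique)
import Data.List.Relation.Unary.Unique.Propositional.Properties as Unique
open import Data.List.Relation.Binary.Pointwise as Pointwise using (Pointwise; []; _∷_; Pointwise-length; lookup-cast)
open import Data.List.Relation.Binary.Disjoint.Propositional using (Disjoint)
open import Data.List.Membership.Propositional using (_∈_; _∉_)
open import Data.List.Membership.Propositional.Properties
  using (∈-lookup; ∈-allFin; ∈-filter⁺; ∈-filter⁻; ∈-map⁺; ∈-map⁻; ∈-++⁺ˡ; ∈-++⁺ʳ; ∈-++⁻)
open import Data.List.Membership.DecPropositional _≟ℕ_ using (_∈?_)
open import Function using (_∘_)
open import Function.Bundles using (_⇔_; Equivalence; mk↔ₛ′; mk⇔)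
open import Relation.Nullary using (¬_; Dec; yes; no; ¬?; _×-dec_; _→-dec_; contradiction)
open import Relation.Nullary.Decidable using (⌊_⌋; toWitness)
open import Relation.Unary using (Decidable)
open import Relation.Binary.Definitions using (DecidableEquality)
open import Relation.Binary.PropositionalEquality using (_≡_; _≢_; refl; sym; trans; cong; cong₂; subst)

∨-false : ∀ {x y} → x ∨ y ≡ false → x ≡ false × y ≡ false
∨-false {false} {false} refl = refl , refl

all-sound : ∀ {A : Set} (p : A → Bool) xs → T (all p xs) → All (T ∘ p) xs
all-sound p []       _ = []
all-sound p (x ∷ xs) t = let tx , txs = Equivalence.to (T-∧ {p x}) t in tx ∷ all-sound p xs txs

length-∅ : ∀ {A : Set} {xs : List A} → (∀ {x} → x ∉ xs) → length xs ≡ 0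
length-∅ {xs = []}    _   = refl
length-∅ {xs = x ∷ _} ∉xs = ⊥-elim (∉xs (here refl))

lookup-map : ∀ {A B : Set} (g : A → B) (xs : List A) k →
  lookup (map g xs) k ≡ g (lookup xs (cast (length-map g xs) k))
lookup-map g (x ∷ xs) zero    = refl
lookup-map g (x ∷ xs) (suc k) = lookup-map g xs k

lookup-injective : ∀ {A : Set} {xs : List A} → Unique xs → ∀ i j → lookup xs i ≡ lookup xs j → i ≡ j
lookup-injective (_  ∷ _) zero    zero    _ = refl
lookup-injective (x∉ ∷ _) zero    (suc j) e = ⊥-elim (All.lookup x∉ (∈-lookup j) e)
lookup-injective (x∉ ∷ _) (suc i) zero    e = ⊥-elim (All.lookup x∉ (∈-lookup i) (sym e))
lookup-injective (_  ∷ u) (suc i) (suc j) e = cong suc (lookup-injective u i j e)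

cast-injective : ∀ {m n} (eq : m ≡ n) {k l : Fin m} → cast eq k ≡ cast eq l → k ≡ l
cast-injective eq {k} {l} e =
  trans (sym (cast-involutive (sym eq) eq k)) (trans (cong (cast (sym eq)) e) (cast-involutive (sym eq) eq l))

InducesCycle : ∀ m {V : Set} → (V → V → Bool) → (Fin (suc m) → V) → Set
InducesCycle m A w = ∀ i j → A (w i) (w j) ≡ cycleAdj i j

inducesCycle? : ∀ m {V : Set} (A : V → V → Bool) (w : Fin (suc m) → V) → Dec (InducesCycle m A w)
inducesCycle? m A w = all? λ i → all? λ j → A (w i) (w j) Bool.≟ cycleAdj i j

cycleAdj-sym : ∀ {m} (i j : Fin (suc m)) → cycleAdj i j ≡ cycleAdj j i
cycleAdj-sym {m} i j = Bool.∨-comm (suc (toℕ i) % suc m ≡ᵇ toℕ j) (suc (toℕ j) % suc m ≡ᵇ toℕ i)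

CycleVerticesSeparated : ℕ → Set
CycleVerticesSeparated m = ∀ (i j : Fin (suc m)) → (∀ k → cycleAdj i k ≡ cycleAdj j k) → i ≡ j

cycleVerticesSeparated? : ∀ m → Dec (CycleVerticesSeparated m)
cycleVerticesSeparated? m =
  all? λ i → all? λ j → (all? λ k → cycleAdj i k Bool.≟ cycleAdj j k) →-dec (i ≟ j)

C₅-separated : CycleVerticesSeparated 4
C₅-separated = toWitness {a? = cycleVerticesSeparated? 4} _

C₆-separated : CycleVerticesSeparated 5
C₆-separated = toWitness {a? = cycleVerticesSeparated? 5} _

inducesCycle⇒injective : ∀ {m V} (A : V → V → Bool) (w : Fin (suc m) → V) →
  CycleVerticesSeparated m → InducesCycle m A w → ∀ i j → w i ≡ w j → i ≡ j
inducesCycle⇒injective A w separated induced i j wi≡wj = separated i j λ k →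
  trans (sym (induced i k)) (trans (cong (λ x → A x (w k)) wi≡wj) (induced j k))

inducedCycle : ∀ {m V} (A : V → V → Bool) (w : Fin (suc m) → V) →
  CycleVerticesSeparated m → InducesCycle m A w → HasInducedCycle m A
inducedCycle A w separated induced = w , inducesCycle⇒injective A w separated induced , induced

inducedC₅ : ∀ {V} (A : V → V → Bool) (w : Fin 5 → V) → InducesCycle 4 A w → HasInducedCycle 4 A
inducedC₅ A w = inducedCycle A w C₅-separated

inducedC₆ : ∀ {V} (A : V → V → Bool) (w : Fin 6 → V) → InducesCycle 5 A w → HasInducedCycle 5 A
inducedC₆ A w = inducedCycle A w C₆-separated

◂-matches : ∀ {m} {V : Set} (A : V → V → Bool) → (∀ x y → A x y ≡ A y x) →
  (P : Fin (suc m) → Fin (suc m) → Bool) → (∀ j → P (suc j) zero ≡ P zero (suc j)) →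
  P zero zero ≡ false →
  ∀ {x} {p : Fin m → V} → A x x ≡ false →
  (∀ j → A x (p j) ≡ P zero (suc j)) → (∀ i j → A (p i) (p j) ≡ P (suc i) (suc j)) →
  ∀ i j → A ((x ◂ p) i) ((x ◂ p) j) ≡ P i j
◂-matches A A-sym P P-sym P-irrefl x-irrefl x-p p-p zero    zero    = trans x-irrefl (sym P-irrefl)
◂-matches A A-sym P P-sym P-irrefl x-irrefl x-p p-p zero    (suc j) = x-p j
◂-matches A A-sym P P-sym P-irrefl x-irrefl x-p p-p (suc i) zero    =
  trans (A-sym _ _) (trans (x-p i) (sym (P-sym i)))
◂-matches A A-sym P P-sym P-irrefl x-irrefl x-p p-p (suc i) (suc j) = p-p i j

PreservesCycle : ∀ {m} → (Fin (suc m) → Fin (suc m)) → Set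
PreservesCycle σ = ∀ i j → cycleAdj (σ i) (σ j) ≡ cycleAdj i j

inducesCycle-∘ : ∀ {m V} (A : V → V → Bool) (w : Fin (suc m) → V) {σ} →
  PreservesCycle σ → InducesCycle m A w → InducesCycle m A (w ∘ σ)
inducesCycle-∘ A w {σ} preserves induced i j = trans (induced (σ i) (σ j)) (preserves i j)

-- i ↦ k + i, or i ↦ k − i when reflected
dihedral : Bool → Fin 5 → Fin 5 → Fin 5
dihedral false k i = (toℕ k + toℕ i) mod 5
dihedral true  k i = (toℕ k + 4 * toℕ i) mod 5

dihedral-preserves : ∀ b k → PreservesCycle (dihedral b k)
dihedral-preserves false = toWitness {a? = all? λ k → all? λ i → all? λ j →
  cycleAdj (dihedral false k i) (dihedral false k j) Bool.≟ cycleAdj i j} _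
dihedral-preserves true  = toWitness {a? = all? λ k → all? λ i → all? λ j →
  cycleAdj (dihedral true k i) (dihedral true k j) Bool.≟ cycleAdj i j} _

dihedral-surjective : ∀ b k j → ∃ λ i → dihedral b k i ≡ j
dihedral-surjective false = toWitness {a? = all? λ k → all? λ j → any? λ i → dihedral false k i ≟ j} _
dihedral-surjective true  = toWitness {a? = all? λ k → all? λ j → any? λ i → dihedral true k i ≟ j} _

rotation-zero : ∀ k → dihedral false k 0F ≡ k
rotation-zero = toWitness {a? = all? λ k → dihedral false k 0F ≟ k} _

C₅-path≡C₆-path : ∀ (i j : Fin 4) → cycleAdj {4} (suc i) (suc j) ≡ cycleAdj {5} (suc (suc i)) (suc (suc j))
C₅-path≡C₆-path = toWitness {a? = all? λ i → all? λ j →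
  cycleAdj {4} (suc i) (suc j) Bool.≟ cycleAdj {5} (suc (suc i)) (suc (suc j))} _

module _ {V : Set} (_≟V_ : DecidableEquality V) (A : V → V → Bool) where

  Contract : V → V → V → V → Bool
  Contract u v x y =
    if ⌊ x ≟V y ⌋ then false
    else if ⌊ x ≟V u ⌋ then (A u y ∨ A v y)
    else if ⌊ y ≟V u ⌋ then (A x u ∨ A x v)
    else A x y

  module _ (A-irrefl : ∀ x → A x x ≡ false) {u v : V} where

    Contract-away : ∀ {x y} → x ≢ u → y ≢ u → Contract u v x y ≡ A x y
    Contract-away {x} {y} x≢u y≢u with x ≟V y
    ... | yes refl = sym (A-irrefl x)
    ... | no _ with x ≟V u
    ...   | yes x≡u = ⊥-elim (x≢u x≡u)
    ...   | no _ with y ≟V u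
    ...     | yes y≡u = ⊥-elim (y≢u y≡u)
    ...     | no _    = refl

    Contract-merged : ∀ {y} → y ≢ u → Contract u v u y ≡ (A u y ∨ A v y)
    Contract-merged {y} y≢u with u ≟V y
    ... | yes u≡y = ⊥-elim (y≢u (sym u≡y))
    ... | no _ with u ≟V u
    ...   | yes _   = refl
    ...   | no u≢u = ⊥-elim (u≢u refl)

module _ {V W : Set} (_≟V_ : DecidableEquality V) (_≟W_ : DecidableEquality W)
  {A : V → V → Bool} {B : W → W → Bool} {g : V → W}
  (g-injective : ∀ {x y} → g x ≡ g y → x ≡ y) (g-adj : ∀ x y → B (g x) (g y) ≡ A x y) where

  ⌊≟⌋-embedding : ∀ x y → ⌊ g x ≟W g y ⌋ ≡ ⌊ x ≟V y ⌋
  ⌊≟⌋-embedding x y with x ≟V y | g x ≟W g y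
  ... | yes refl | yes _     = refl
  ... | yes refl | no gx≢gx  = ⊥-elim (gx≢gx refl)
  ... | no  _    | no  _     = refl
  ... | no  x≢y  | yes gx≡gy = ⊥-elim (x≢y (g-injective gx≡gy))

  Contract-embedding : ∀ a b x y → Contract _≟W_ B (g a) (g b) (g x) (g y) ≡ Contract _≟V_ A a b x y
  Contract-embedding a b x y
    rewrite ⌊≟⌋-embedding x y | ⌊≟⌋-embedding x a | ⌊≟⌋-embedding y a
          | g-adj a y | g-adj b y | g-adj x a | g-adj x b | g-adj x y = refl

-- Contractions of a C₅-free and C₆-free graph

Sees : ∀ {n k} (G : Graph n) → (Fin k → Fin n) → Fin n → (Fin k → Bool) → Set
Sees G h x N = ∀ i → adj G x (h i) ≡ N i

ends : Bool → Bool → Fin 4 → Bool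
ends a b 0F = a
ends a b 1F = false
ends a b 2F = false
ends a b 3F = b

module C₅FreeContraction {n} (G : Graph n) (c5 : C5Free (adj G)) (c6 : C6Free (adj G)) where

  module _ {p : Fin 4 → Fin n} (path : ∀ i j → adj G (p i) (p j) ≡ cycleAdj (suc i) (suc j)) where

    sees-ends : ∀ {x a b} → adj G x (p 0F) ≡ a → adj G x (p 1F) ≡ false →
      adj G x (p 2F) ≡ false → adj G x (p 3F) ≡ b → Sees G p x (ends a b)
    sees-ends x₀ x₁ x₂ x₃ 0F = x₀
    sees-ends x₀ x₁ x₂ x₃ 1F = x₁
    sees-ends x₀ x₁ x₂ x₃ 2F = x₂
    sees-ends x₀ x₁ x₂ x₃ 3F = x₃

    no-C₅-apex : ∀ {x} → Sees G p x (ends true true) → ⊥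
    no-C₅-apex {x} x-p = c5 (inducedC₅ (adj G) (x ◂ p)
      (◂-matches (adj G) (adj-sym G) cycleAdj (λ j → cycleAdj-sym (suc j) zero) refl (adj-irrefl G x)
        (λ { 0F → x-p 0F ; 1F → x-p 1F ; 2F → x-p 2F ; 3F → x-p 3F }) path))

    no-C₆-apices : ∀ {x y} → adj G y x ≡ true → Sees G p x (ends true false) → Sees G p y (ends false true) → ⊥
    no-C₆-apices {x} {y} yx x-p y-p = c6 (inducedC₆ (adj G) (y ◂ x ◂ p)
      (◂-matches (adj G) (adj-sym G) cycleAdj (λ j → cycleAdj-sym (suc j) zero) refl (adj-irrefl G y)
        (λ { 0F → yx ; 1F → y-p 0F ; 2F → y-p 1F ; 3F → y-p 2F ; 4F → y-p 3F })
        (◂-matches (adj G) (adj-sym G) (λ i j → cycleAdj (suc i) (suc j))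
          (λ j → cycleAdj-sym (suc (suc j)) 1F) refl (adj-irrefl G x)
          (λ { 0F → x-p 0F ; 1F → x-p 1F ; 2F → x-p 2F ; 3F → x-p 3F })
          (λ i j → trans (path i j) (C₅-path≡C₆-path i j)))))

    no-merged-apex : ∀ {u v} → adj G u v ≡ true →
      (∀ j → (adj G u (p j) ∨ adj G v (p j)) ≡ cycleAdj zero (suc j)) → ⊥
    no-merged-apex {u} {v} uv merged
      with ∨-false (merged 1F) | ∨-false (merged 2F)
    ... | u₁ , v₁ | u₂ , v₂
      with adj G u (p 0F) in u₀ | adj G v (p 0F) in v₀ | adj G u (p 3F) in u₃ | adj G v (p 3F) in v₃
    ... | true  | _     | true  | _     = no-C₅-apex (sees-ends u₀ u₁ u₂ u₃)
    ... | _     | true  | _     | true  = no-C₅-apex (sees-ends v₀ v₁ v₂ v₃)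
    ... | true  | false | false | true  =
      no-C₆-apices (trans (adj-sym G v u) uv) (sees-ends u₀ u₁ u₂ u₃) (sees-ends v₀ v₁ v₂ v₃)
    ... | false | true  | true  | false = no-C₆-apices uv (sees-ends v₀ v₁ v₂ v₃) (sees-ends u₀ u₁ u₂ u₃)
    ... | false | false | _     | _     = contradiction (trans (sym (cong₂ _∨_ u₀ v₀)) (merged 0F)) λ ()
    ... | _     | _     | false | false = contradiction (trans (sym (cong₂ _∨_ u₃ v₃)) (merged 3F)) λ ()

  contraction-C5Free : ∀ {u v} → adj G u v ≡ true → C5Free (contract G u v)
  contraction-C5Free {u} {v} uv (w , _ , w-cycle) with any? (λ k → proj₁ (w k) ≟ u)
  ... | no u∉w = c5 (inducedC₅ (adj G) (proj₁ ∘ w) λ i j →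
          trans (sym (Contract-away _≟_ (adj G) (adj-irrefl G) (u∉w ∘ (i ,_)) (u∉w ∘ (j ,_)))) (w-cycle i j))
  ... | yes (k , wk≡u) = no-merged-apex path uv merged
    where
    A/uv : Fin n → Fin n → Bool
    A/uv = Contract _≟_ (adj G) u v
    z : Fin 5 → Fin n
    z = proj₁ ∘ w ∘ dihedral false k
    z-cycle : InducesCycle 4 A/uv z
    z-cycle = inducesCycle-∘ A/uv (proj₁ ∘ w) (dihedral-preserves false k) w-cycle
    z₀≡u : z 0F ≡ u
    z₀≡u = trans (cong (proj₁ ∘ w) (rotation-zero k)) wk≡u
    zₛ≢u : ∀ j → z (suc j) ≢ u
    zₛ≢u j zⱼ≡u = 0≢1+n (inducesCycle⇒injective A/uv z C₅-separated z-cycle 0F (suc j) (trans z₀≡u (sym zⱼ≡u)))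
    path : ∀ i j → adj G (z (suc i)) (z (suc j)) ≡ cycleAdj (suc i) (suc j)
    path i j = trans (sym (Contract-away _≟_ (adj G) (adj-irrefl G) (zₛ≢u i) (zₛ≢u j))) (z-cycle (suc i) (suc j))
    merged : ∀ j → (adj G u (z (suc j)) ∨ adj G v (z (suc j))) ≡ cycleAdj zero (suc j)
    merged j = trans (sym (Contract-merged _≟_ (adj G) (adj-irrefl G) (zₛ≢u j)))
      (subst (λ x → A/uv x (z (suc j)) ≡ cycleAdj zero (suc j)) z₀≡u (z-cycle 0F (suc j)))

-- Neighbourhood codes and profiles

-- bit i of the code records adjacency to vertex i of the cycle, so that for
-- instance 13 codes {r, t, u}
bit : Bool → ℕ
bit b = if b then 1 else 0

encode : ∀ {k} → (Fin k → Bool) → ℕ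
encode {zero}  N = 0
encode {suc k} N = bit (N zero) + encode (N ∘ suc) * 2

decode : ∀ {k} → ℕ → Fin k → Bool
decode c zero    = c % 2 ≡ᵇ 1
decode c (suc i) = decode (c / 2) i

decode-encode : ∀ {k} (N : Fin k → Bool) i → decode (encode N) i ≡ N i
decode-encode N zero with N zero
... | false = cong (_≡ᵇ 1) ([m+kn]%n≡m%n 0 (encode (N ∘ suc)) 2)
... | true  = cong (_≡ᵇ 1) ([m+kn]%n≡m%n 1 (encode (N ∘ suc)) 2)
decode-encode N (suc i) = trans (cong (λ c → decode c i) halve) (decode-encode (N ∘ suc) i)
  where
  halve : (bit (N zero) + encode (N ∘ suc) * 2) / 2 ≡ encode (N ∘ suc)
  halve with N zero
  ... | false = m*n/n≡m (encode (N ∘ suc)) 2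
  ... | true  = trans (+-distrib-/-∣ʳ 1 {encode (N ∘ suc) * 2} {2} (divides (encode (N ∘ suc)) refl))
                      (m*n/n≡m (encode (N ∘ suc)) 2)

decode-zero : ∀ {k} (i : Fin k) → decode 0 i ≡ false
decode-zero zero    = refl
decode-zero (suc i) = decode-zero i

encode-< : ∀ {k} (N : Fin k → Bool) → encode N < 2 ^ k
encode-< {zero}  N = s≤s z≤n
encode-< {suc k} N =
  ≤-trans (s≤s (+-monoˡ-≤ (encode (N ∘ suc) * 2) (bit≤1 (N zero))))
    (≤-trans (*-monoˡ-≤ 2 (encode-< (N ∘ suc))) (≤-reflexive (*-comm (2 ^ k) 2)))
  where
  bit≤1 : ∀ b → bit b ≤ 1
  bit≤1 false = z≤n
  bit≤1 true  = s≤s z≤n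

occurrences : ℕ → List ℕ → ℕ
occurrences c []       = 0
occurrences c (d ∷ ds) = if c ≡ᵇ d then suc (occurrences c ds) else occurrences c ds

occurrences-self : ∀ c cs → occurrences c (c ∷ cs) ≡ suc (occurrences c cs)
occurrences-self c cs with c ≡ᵇ c | ≡⇒≡ᵇ c c refl
... | true | _ = refl

occurrences-other : ∀ {c d} cs → c ≢ d → occurrences c (d ∷ cs) ≡ occurrences c cs
occurrences-other {c} {d} cs c≢d with c ≡ᵇ d | ≡ᵇ⇒≡ c d
... | false | _   = refl
... | true  | c≡d = ⊥-elim (c≢d (c≡d _))

occurrences-∉ : ∀ {c} cs → c ∉ cs → occurrences c cs ≡ 0
occurrences-∉ []       _  = refl
occurrences-∉ (d ∷ ds) c∉ = trans (occurrences-other ds (c∉ ∘ here)) (occurrences-∉ ds (c∉ ∘ there))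

module _ {X : Set} (class : X → ℕ) where

  -- The first position gets the head of its list, which is removed for the rest.
  representatives : ∀ (B : ℕ → List X) → (∀ c → Unique (B c)) → (∀ {c x} → x ∈ B c → class x ≡ c) →
    ∀ cs → (∀ c → occurrences c cs ≤ length (B c)) →
    Σ (Fin (length cs) → X) λ r → (∀ k l → r k ≡ r l → k ≡ l) × (∀ k → r k ∈ B (lookup cs k))
  representatives B unique classed [] _ = (λ ()) , (λ ()) , (λ ())
  representatives B unique classed (c ∷ cs) bound with B c in Bc≡ | unique c | bound c
  ... | [] | _ | occ≤0 = contradiction (subst (_≤ 0) (occurrences-self c cs) occ≤0) λ ()
  ... | x ∷ rest | x∉rest ∷ rest-unique | occ≤ = r , r-injective , r-∈
    where
    x∈Bc : x ∈ B c
    x∈Bc = subst (x ∈_) (sym Bc≡) (here refl)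
    B′ : ℕ → List X
    B′ d with d ≟ℕ c
    ... | yes _ = rest
    ... | no  _ = B d
    B′-unique : ∀ d → Unique (B′ d)
    B′-unique d with d ≟ℕ c
    ... | yes _ = rest-unique
    ... | no  _ = unique d
    B′⊆B : ∀ {d y} → y ∈ B′ d → y ∈ B d
    B′⊆B {d} y∈ with d ≟ℕ c
    ... | yes refl = subst (_ ∈_) (sym Bc≡) (there y∈)
    ... | no  _    = y∈
    B′-bound : ∀ d → occurrences d cs ≤ length (B′ d)
    B′-bound d with d ≟ℕ c
    ... | yes refl = s≤s⁻¹ (subst (_≤ suc (length rest)) (occurrences-self c cs) occ≤)
    ... | no d≢c   = subst (_≤ length (B d)) (occurrences-other cs d≢c) (bound d)
    x∉B′ : ∀ d → x ∉ B′ d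
    x∉B′ d x∈ with d ≟ℕ c
    ... | yes _  = All.lookup x∉rest x∈ refl
    ... | no d≢c = d≢c (trans (sym (classed x∈)) (classed x∈Bc))
    rec : Σ (Fin (length cs) → X) λ r → (∀ k l → r k ≡ r l → k ≡ l) × (∀ k → r k ∈ B′ (lookup cs k))
    rec = representatives B′ B′-unique (λ y∈ → classed (B′⊆B y∈)) cs B′-bound
    rec-injective : ∀ k l → proj₁ rec k ≡ proj₁ rec l → k ≡ l
    rec-injective = proj₁ (proj₂ rec)
    rec-∈ : ∀ k → proj₁ rec k ∈ B′ (lookup cs k)
    rec-∈ = proj₂ (proj₂ rec)
    r : Fin (suc (length cs)) → X
    r zero    = x
    r (suc k) = proj₁ rec k
    r-∈ : ∀ k → r k ∈ B (lookup (c ∷ cs) k)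
    r-∈ zero    = x∈Bc
    r-∈ (suc k) = B′⊆B (rec-∈ k)
    r-injective : ∀ k l → r k ≡ r l → k ≡ l
    r-injective zero    zero    _  = refl
    r-injective zero    (suc l) x≡ = ⊥-elim (x∉B′ (lookup cs l) (subst (_∈ B′ (lookup cs l)) (sym x≡) (rec-∈ l)))
    r-injective (suc k) zero    ≡x = ⊥-elim (x∉B′ (lookup cs k) (subst (_∈ B′ (lookup cs k)) ≡x (rec-∈ k)))
    r-injective (suc k) (suc l) eq = cong suc (rec-injective k l eq)

-- Entry c of a profile is the number of vertices off the cycle with code c,
-- capped at 2.
Profile : Set
Profile = List ℕ

entry : Profile → ℕ → ℕ
entry []      _       = 0
entry (k ∷ q) zero    = k
entry (k ∷ q) (suc c) = entry q c

entry-++ : ∀ q ext c → entry q c ≤ entry (q ++ ext) c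
entry-++ []      ext c       = z≤n
entry-++ (k ∷ q) ext zero    = ≤-refl
entry-++ (k ∷ q) ext (suc c) = entry-++ q ext c

entry-applyUpTo : ∀ (P : ℕ → ℕ) {k c} → c < k → entry (applyUpTo P k) c ≡ P c
entry-applyUpTo P {suc k} {zero}  _         = refl
entry-applyUpTo P {suc k} {suc c} (s≤s c<k) = entry-applyUpTo (P ∘ suc) c<k

entry-applyUpTo-≢0 : ∀ (P : ℕ → ℕ) k c → entry (applyUpTo P k) c ≢ 0 → entry (applyUpTo P k) c ≡ P c
entry-applyUpTo-≢0 P zero    c       nonzero = ⊥-elim (nonzero refl)
entry-applyUpTo-≢0 P (suc k) zero    _       = refl
entry-applyUpTo-≢0 P (suc k) (suc c) nonzero = entry-applyUpTo-≢0 (P ∘ suc) k c nonzero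

entry-applyUpTo-≤ : ∀ (P : ℕ → ℕ) k c → entry (applyUpTo P k) c ≤ P c
entry-applyUpTo-≤ P zero    c       = z≤n
entry-applyUpTo-≤ P (suc k) zero    = ≤-refl
entry-applyUpTo-≤ P (suc k) (suc c) = entry-applyUpTo-≤ (P ∘ suc) k c

length⊓2≢0 : ∀ {A : Set} {xs : List A} {x} → x ∈ xs → length xs ⊓ 2 ≢ 0
length⊓2≢0 {xs = _ ∷ _} _ ()

⊓2≡1 : ∀ {m} → m ⊓ 2 ≡ 1 → m ≡ 1
⊓2≡1 {1}           _ = refl
⊓2≡1 {0}           ()
⊓2≡1 {suc (suc m)} ()

Present : Profile → List ℕ → Set
Present q cs = ∀ c → occurrences c cs ≤ entry q c

present : Profile → List ℕ → Bool
present q cs = all (λ c → occurrences c cs ≤ᵇ entry q c) cs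

present-sound : ∀ q cs → T (present q cs) → Present q cs
present-sound q cs p c with c ∈? cs
... | yes c∈cs = ≤ᵇ⇒≤ _ _ (All.lookup (all-sound _ cs p) c∈cs)
... | no  c∉cs = subst (_≤ entry q c) (sym (occurrences-∉ cs c∉cs)) z≤n

Present-++ : ∀ q ext {cs} → Present q cs → Present (q ++ ext) cs
Present-++ q ext present c = ≤-trans (present c) (entry-++ q ext c)

infix 4 _∈ᵇ_
_∈ᵇ_ : ℕ → List ℕ → Bool
c ∈ᵇ cs = any (c ≡ᵇ_) cs

∈ᵇ-sound : ∀ c cs → T (c ∈ᵇ cs) → c ∈ cs
∈ᵇ-sound c cs t = Any.map (≡ᵇ⇒≡ c _) (any⁻ _ cs t)

supportedBy : List ℕ → ℕ → Profile → Bool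
supportedBy cs c []      = true
supportedBy cs c (k ∷ q) = ((k ≡ᵇ 0) ∨ (c ∈ᵇ cs)) ∧ supportedBy cs (suc c) q

supportedBy-sound : ∀ cs c q → T (supportedBy cs c q) → ∀ d → entry q d ≢ 0 → c + d ∈ cs
supportedBy-sound cs c []      _ d nonzero = ⊥-elim (nonzero refl)
supportedBy-sound cs c (k ∷ q) t d nonzero with Equivalence.to (T-∧ {(k ≡ᵇ 0) ∨ (c ∈ᵇ cs)}) t
supportedBy-sound cs c (k ∷ q) t zero nonzero | first , _ with Equivalence.to (T-∨ {k ≡ᵇ 0}) first
... | inj₁ k≡0  = ⊥-elim (nonzero (≡ᵇ⇒≡ k 0 k≡0))
... | inj₂ c∈cs = subst (_∈ cs) (sym (+-identityʳ c)) (∈ᵇ-sound c cs c∈cs)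
supportedBy-sound cs c (k ∷ q) t (suc d) nonzero | _ , later =
  subst (_∈ cs) (sym (+-suc c d)) (supportedBy-sound cs (suc c) q later d nonzero)

-- Obstructions and exceptional families

≟-ExcV : (L : List Nbhd) → DecidableEquality (ExcV L)
≟-ExcV L = ≡-dec _≟_ _≟_

ContractsToC₅ : (L : List Nbhd) (a b : ExcV L) → (Fin 5 → ExcV L) → Set
ContractsToC₅ L a b w =
  excAdj L a b ≡ true × (∀ i → w i ≢ b) × InducesCycle 4 (Contract (≟-ExcV L) (excAdj L) a b) w

contractsToC₅? : ∀ L a b w → Dec (ContractsToC₅ L a b w)
contractsToC₅? L a b w = (excAdj L a b Bool.≟ true) ×-dec (all? λ i → ¬? (≟-ExcV L (w i) b))
  ×-dec inducesCycle? 4 (Contract (≟-ExcV L) (excAdj L) a b) w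

-- codes of the added vertices, an edge ab, and an induced C₅ of the graph
-- obtained by contracting ab
data Obstruction : Set where
  obstruction : (cs : List ℕ) (a b : ExcV (map decode cs)) → Vec (ExcV (map decode cs)) 5 → Obstruction

codes : Obstruction → List ℕ
codes (obstruction cs _ _ _) = cs

Valid : Obstruction → Set
Valid (obstruction cs a b w) = ContractsToC₅ (map decode cs) a b (Vec.lookup w)

valid? : ∀ o → Dec (Valid o)
valid? (obstruction cs a b w) = contractsToC₅? (map decode cs) a b (Vec.lookup w)

-- grouped by the largest code involved, from 1 to 31
obstructions : List (List Obstruction)
obstructions =
  (obstruction (1 ∷ []) (inj₁ 0F) (inj₂ 0F) (inj₁ 0F ∷ inj₁ 1F ∷ inj₁ 2F ∷ inj₁ 3F ∷ inj₁ 4F ∷ []) ∷ []) ∷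
  (obstruction (2 ∷ []) (inj₁ 1F) (inj₂ 0F) (inj₁ 0F ∷ inj₁ 1F ∷ inj₁ 2F ∷ inj₁ 3F ∷ inj₁ 4F ∷ []) ∷ []) ∷
  (obstruction (3 ∷ []) (inj₁ 0F) (inj₂ 0F) (inj₁ 0F ∷ inj₁ 1F ∷ inj₁ 2F ∷ inj₁ 3F ∷ inj₁ 4F ∷ []) ∷ []) ∷
  (obstruction (4 ∷ []) (inj₁ 2F) (inj₂ 0F) (inj₁ 0F ∷ inj₁ 1F ∷ inj₁ 2F ∷ inj₁ 3F ∷ inj₁ 4F ∷ []) ∷ []) ∷
  [] ∷
  (obstruction (6 ∷ []) (inj₁ 1F) (inj₂ 0F) (inj₁ 0F ∷ inj₁ 1F ∷ inj₁ 2F ∷ inj₁ 3F ∷ inj₁ 4F ∷ []) ∷ []) ∷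
  (obstruction (7 ∷ []) (inj₁ 1F) (inj₂ 0F) (inj₁ 0F ∷ inj₁ 1F ∷ inj₁ 2F ∷ inj₁ 3F ∷ inj₁ 4F ∷ []) ∷ []) ∷
  (obstruction (8 ∷ []) (inj₁ 3F) (inj₂ 0F) (inj₁ 0F ∷ inj₁ 1F ∷ inj₁ 2F ∷ inj₁ 3F ∷ inj₁ 4F ∷ []) ∷ []) ∷
  [] ∷
  (obstruction (5 ∷ 10 ∷ []) (inj₁ 0F) (inj₂ 0F) (inj₁ 0F ∷ inj₁ 1F ∷ inj₂ 1F ∷ inj₁ 3F ∷ inj₁ 4F ∷ []) ∷ []) ∷
  (obstruction (5 ∷ 11 ∷ []) (inj₁ 1F) (inj₂ 1F) (inj₁ 0F ∷ inj₁ 4F ∷ inj₁ 3F ∷ inj₁ 2F ∷ inj₂ 0F ∷ []) ∷ []) ∷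
  (obstruction (12 ∷ []) (inj₁ 2F) (inj₂ 0F) (inj₁ 0F ∷ inj₁ 1F ∷ inj₁ 2F ∷ inj₁ 3F ∷ inj₁ 4F ∷ []) ∷ []) ∷
  (obstruction (10 ∷ 13 ∷ []) (inj₁ 2F) (inj₂ 1F) (inj₁ 0F ∷ inj₁ 1F ∷ inj₂ 0F ∷ inj₁ 3F ∷ inj₁ 4F ∷ []) ∷ []) ∷
  (obstruction (14 ∷ []) (inj₁ 2F) (inj₂ 0F) (inj₁ 0F ∷ inj₁ 1F ∷ inj₁ 2F ∷ inj₁ 3F ∷ inj₁ 4F ∷ []) ∷ []) ∷
  ( obstruction (5 ∷ 15 ∷ []) (inj₁ 1F) (inj₂ 1F) (inj₁ 0F ∷ inj₁ 4F ∷ inj₁ 3F ∷ inj₁ 2F ∷ inj₂ 0F ∷ [])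
  ∷ obstruction (10 ∷ 15 ∷ []) (inj₁ 2F) (inj₂ 1F) (inj₁ 0F ∷ inj₁ 1F ∷ inj₂ 0F ∷ inj₁ 3F ∷ inj₁ 4F ∷ [])
  ∷ []) ∷
  (obstruction (16 ∷ []) (inj₁ 4F) (inj₂ 0F) (inj₁ 0F ∷ inj₁ 1F ∷ inj₁ 2F ∷ inj₁ 3F ∷ inj₁ 4F ∷ []) ∷ []) ∷
  (obstruction (17 ∷ []) (inj₁ 0F) (inj₂ 0F) (inj₁ 0F ∷ inj₁ 1F ∷ inj₁ 2F ∷ inj₁ 3F ∷ inj₁ 4F ∷ []) ∷ []) ∷
  ( obstruction (5 ∷ 18 ∷ []) (inj₁ 0F) (inj₂ 0F) (inj₁ 1F ∷ inj₁ 2F ∷ inj₁ 3F ∷ inj₁ 4F ∷ inj₂ 1F ∷ [])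
  ∷ obstruction (9 ∷ 18 ∷ []) (inj₁ 0F) (inj₂ 0F) (inj₁ 1F ∷ inj₁ 2F ∷ inj₁ 3F ∷ inj₁ 4F ∷ inj₂ 1F ∷ [])
  ∷ obstruction (11 ∷ 18 ∷ []) (inj₁ 0F) (inj₂ 0F) (inj₁ 1F ∷ inj₁ 2F ∷ inj₁ 3F ∷ inj₁ 4F ∷ inj₂ 1F ∷ [])
  ∷ obstruction (13 ∷ 18 ∷ []) (inj₁ 0F) (inj₂ 0F) (inj₁ 1F ∷ inj₁ 2F ∷ inj₁ 3F ∷ inj₁ 4F ∷ inj₂ 1F ∷ [])
  ∷ obstruction (15 ∷ 18 ∷ []) (inj₁ 0F) (inj₂ 0F) (inj₁ 1F ∷ inj₁ 2F ∷ inj₁ 3F ∷ inj₁ 4F ∷ inj₂ 1F ∷ [])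
  ∷ []) ∷
  (obstruction (19 ∷ []) (inj₁ 0F) (inj₂ 0F) (inj₁ 0F ∷ inj₁ 1F ∷ inj₁ 2F ∷ inj₁ 3F ∷ inj₁ 4F ∷ []) ∷ []) ∷
  ( obstruction (9 ∷ 20 ∷ []) (inj₁ 0F) (inj₂ 0F) (inj₁ 0F ∷ inj₁ 1F ∷ inj₁ 2F ∷ inj₂ 1F ∷ inj₁ 4F ∷ [])
  ∷ obstruction (10 ∷ 20 ∷ []) (inj₁ 1F) (inj₂ 0F) (inj₁ 0F ∷ inj₁ 1F ∷ inj₁ 2F ∷ inj₂ 1F ∷ inj₁ 4F ∷ [])
  ∷ obstruction (11 ∷ 20 ∷ []) (inj₁ 0F) (inj₂ 0F) (inj₁ 0F ∷ inj₁ 1F ∷ inj₁ 2F ∷ inj₂ 1F ∷ inj₁ 4F ∷ [])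
  ∷ obstruction (13 ∷ 20 ∷ []) (inj₁ 3F) (inj₂ 0F) (inj₁ 0F ∷ inj₁ 1F ∷ inj₁ 2F ∷ inj₂ 1F ∷ inj₁ 4F ∷ [])
  ∷ obstruction (15 ∷ 20 ∷ []) (inj₁ 1F) (inj₂ 0F) (inj₁ 0F ∷ inj₁ 1F ∷ inj₁ 2F ∷ inj₂ 1F ∷ inj₁ 4F ∷ [])
  ∷ []) ∷
  ( obstruction (9 ∷ 21 ∷ []) (inj₁ 4F) (inj₂ 1F) (inj₁ 0F ∷ inj₁ 1F ∷ inj₁ 2F ∷ inj₁ 3F ∷ inj₂ 0F ∷ [])
  ∷ obstruction (10 ∷ 21 ∷ []) (inj₁ 0F) (inj₂ 1F) (inj₁ 0F ∷ inj₁ 1F ∷ inj₂ 0F ∷ inj₁ 3F ∷ inj₁ 4F ∷ [])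
  ∷ obstruction (18 ∷ 21 ∷ []) (inj₁ 0F) (inj₂ 1F) (inj₁ 1F ∷ inj₁ 2F ∷ inj₁ 3F ∷ inj₁ 4F ∷ inj₂ 0F ∷ [])
  ∷ obstruction (11 ∷ 11 ∷ 21 ∷ []) (inj₁ 1F) (inj₂ 0F) (inj₁ 0F ∷ inj₂ 1F ∷ inj₁ 3F ∷ inj₁ 2F ∷ inj₂ 2F ∷ [])
  ∷ obstruction (11 ∷ 15 ∷ 21 ∷ []) (inj₁ 1F) (inj₂ 1F) (inj₁ 0F ∷ inj₂ 0F ∷ inj₁ 3F ∷ inj₁ 2F ∷ inj₂ 2F ∷ [])
  ∷ obstruction (21 ∷ 21 ∷ 11 ∷ []) (inj₁ 4F) (inj₂ 0F) (inj₁ 0F ∷ inj₂ 1F ∷ inj₁ 2F ∷ inj₁ 3F ∷ inj₂ 2F ∷ [])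
  ∷ []) ∷
  ( obstruction (5 ∷ 22 ∷ []) (inj₁ 1F) (inj₂ 1F) (inj₁ 0F ∷ inj₁ 4F ∷ inj₁ 3F ∷ inj₁ 2F ∷ inj₂ 0F ∷ [])
  ∷ obstruction (9 ∷ 22 ∷ []) (inj₁ 1F) (inj₂ 1F) (inj₁ 0F ∷ inj₁ 1F ∷ inj₁ 2F ∷ inj₁ 3F ∷ inj₂ 0F ∷ [])
  ∷ obstruction (10 ∷ 22 ∷ []) (inj₁ 2F) (inj₂ 1F) (inj₁ 0F ∷ inj₁ 1F ∷ inj₂ 0F ∷ inj₁ 3F ∷ inj₁ 4F ∷ [])
  ∷ obstruction (11 ∷ 11 ∷ 22 ∷ []) (inj₁ 0F) (inj₂ 0F) (inj₁ 1F ∷ inj₂ 1F ∷ inj₁ 3F ∷ inj₁ 4F ∷ inj₂ 2F ∷ [])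
  ∷ obstruction (11 ∷ 13 ∷ 22 ∷ []) (inj₁ 0F) (inj₂ 0F) (inj₁ 0F ∷ inj₁ 4F ∷ inj₂ 2F ∷ inj₁ 2F ∷ inj₂ 1F ∷ [])
  ∷ obstruction (11 ∷ 15 ∷ 22 ∷ []) (inj₁ 0F) (inj₂ 0F) (inj₁ 0F ∷ inj₁ 4F ∷ inj₂ 2F ∷ inj₁ 2F ∷ inj₂ 1F ∷ [])
  ∷ obstruction (11 ∷ 21 ∷ 22 ∷ []) (inj₁ 0F) (inj₂ 1F) (inj₁ 1F ∷ inj₂ 0F ∷ inj₁ 3F ∷ inj₁ 4F ∷ inj₂ 2F ∷ [])
  ∷ obstruction (22 ∷ 22 ∷ 11 ∷ []) (inj₁ 2F) (inj₂ 0F) (inj₁ 1F ∷ inj₂ 1F ∷ inj₁ 4F ∷ inj₁ 3F ∷ inj₂ 2F ∷ [])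
  ∷ obstruction (13 ∷ 13 ∷ 22 ∷ []) (inj₁ 3F) (inj₂ 0F) (inj₁ 0F ∷ inj₁ 4F ∷ inj₂ 2F ∷ inj₁ 2F ∷ inj₂ 1F ∷ [])
  ∷ obstruction (13 ∷ 15 ∷ 22 ∷ []) (inj₁ 0F) (inj₂ 0F) (inj₁ 1F ∷ inj₂ 1F ∷ inj₁ 3F ∷ inj₁ 4F ∷ inj₂ 2F ∷ [])
  ∷ obstruction (22 ∷ 22 ∷ 13 ∷ []) (inj₁ 1F) (inj₂ 0F) (inj₁ 0F ∷ inj₁ 4F ∷ inj₂ 1F ∷ inj₁ 2F ∷ inj₂ 2F ∷ [])
  ∷ obstruction (15 ∷ 15 ∷ 22 ∷ []) (inj₁ 0F) (inj₂ 0F) (inj₁ 1F ∷ inj₂ 1F ∷ inj₁ 3F ∷ inj₁ 4F ∷ inj₂ 2F ∷ [])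
  ∷ obstruction (15 ∷ 21 ∷ 22 ∷ []) (inj₁ 0F) (inj₂ 1F) (inj₁ 1F ∷ inj₂ 0F ∷ inj₁ 3F ∷ inj₁ 4F ∷ inj₂ 2F ∷ [])
  ∷ obstruction (22 ∷ 22 ∷ 15 ∷ []) (inj₁ 1F) (inj₂ 0F) (inj₁ 0F ∷ inj₁ 4F ∷ inj₂ 1F ∷ inj₁ 2F ∷ inj₂ 2F ∷ [])
  ∷ []) ∷
  ( obstruction (5 ∷ 23 ∷ []) (inj₁ 1F) (inj₂ 1F) (inj₁ 0F ∷ inj₁ 4F ∷ inj₁ 3F ∷ inj₁ 2F ∷ inj₂ 0F ∷ [])
  ∷ obstruction (9 ∷ 23 ∷ []) (inj₁ 1F) (inj₂ 1F) (inj₁ 0F ∷ inj₁ 1F ∷ inj₁ 2F ∷ inj₁ 3F ∷ inj₂ 0F ∷ [])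
  ∷ obstruction (10 ∷ 23 ∷ []) (inj₁ 0F) (inj₂ 1F) (inj₁ 0F ∷ inj₁ 1F ∷ inj₂ 0F ∷ inj₁ 3F ∷ inj₁ 4F ∷ [])
  ∷ obstruction (18 ∷ 23 ∷ []) (inj₁ 0F) (inj₂ 1F) (inj₁ 1F ∷ inj₁ 2F ∷ inj₁ 3F ∷ inj₁ 4F ∷ inj₂ 0F ∷ [])
  ∷ obstruction (11 ∷ 11 ∷ 23 ∷ []) (inj₁ 0F) (inj₂ 0F) (inj₁ 1F ∷ inj₂ 1F ∷ inj₁ 3F ∷ inj₁ 4F ∷ inj₂ 2F ∷ [])
  ∷ obstruction (11 ∷ 13 ∷ 23 ∷ []) (inj₁ 0F) (inj₂ 1F) (inj₁ 1F ∷ inj₂ 0F ∷ inj₁ 3F ∷ inj₁ 4F ∷ inj₂ 2F ∷ [])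
  ∷ obstruction (11 ∷ 15 ∷ 23 ∷ []) (inj₁ 0F) (inj₂ 0F) (inj₁ 1F ∷ inj₂ 1F ∷ inj₁ 3F ∷ inj₁ 4F ∷ inj₂ 2F ∷ [])
  ∷ obstruction (11 ∷ 21 ∷ 23 ∷ []) (inj₁ 0F) (inj₂ 1F) (inj₁ 1F ∷ inj₂ 0F ∷ inj₁ 3F ∷ inj₁ 4F ∷ inj₂ 2F ∷ [])
  ∷ obstruction (11 ∷ 22 ∷ 23 ∷ []) (inj₁ 0F) (inj₂ 2F) (inj₁ 1F ∷ inj₂ 0F ∷ inj₁ 3F ∷ inj₁ 4F ∷ inj₂ 1F ∷ [])
  ∷ obstruction (23 ∷ 23 ∷ 11 ∷ []) (inj₁ 0F) (inj₂ 0F) (inj₁ 1F ∷ inj₂ 1F ∷ inj₁ 4F ∷ inj₁ 3F ∷ inj₂ 2F ∷ [])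
  ∷ obstruction (13 ∷ 15 ∷ 23 ∷ []) (inj₁ 0F) (inj₂ 0F) (inj₁ 1F ∷ inj₂ 1F ∷ inj₁ 3F ∷ inj₁ 4F ∷ inj₂ 2F ∷ [])
  ∷ obstruction (13 ∷ 22 ∷ 23 ∷ []) (inj₁ 1F) (inj₂ 2F) (inj₁ 0F ∷ inj₁ 4F ∷ inj₂ 1F ∷ inj₁ 2F ∷ inj₂ 0F ∷ [])
  ∷ obstruction (15 ∷ 15 ∷ 23 ∷ []) (inj₁ 0F) (inj₂ 0F) (inj₁ 1F ∷ inj₂ 1F ∷ inj₁ 3F ∷ inj₁ 4F ∷ inj₂ 2F ∷ [])
  ∷ obstruction (15 ∷ 21 ∷ 23 ∷ []) (inj₁ 0F) (inj₂ 1F) (inj₁ 1F ∷ inj₂ 0F ∷ inj₁ 3F ∷ inj₁ 4F ∷ inj₂ 2F ∷ [])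
  ∷ obstruction (15 ∷ 22 ∷ 23 ∷ []) (inj₁ 0F) (inj₂ 2F) (inj₁ 1F ∷ inj₂ 0F ∷ inj₁ 3F ∷ inj₁ 4F ∷ inj₂ 1F ∷ [])
  ∷ obstruction (23 ∷ 23 ∷ 15 ∷ []) (inj₁ 0F) (inj₂ 0F) (inj₁ 1F ∷ inj₂ 1F ∷ inj₁ 4F ∷ inj₁ 3F ∷ inj₂ 2F ∷ [])
  ∷ []) ∷
  (obstruction (24 ∷ []) (inj₁ 3F) (inj₂ 0F) (inj₁ 0F ∷ inj₁ 1F ∷ inj₁ 2F ∷ inj₁ 3F ∷ inj₁ 4F ∷ []) ∷ []) ∷
  (obstruction (25 ∷ []) (inj₁ 4F) (inj₂ 0F) (inj₁ 0F ∷ inj₁ 1F ∷ inj₁ 2F ∷ inj₁ 3F ∷ inj₁ 4F ∷ []) ∷ []) ∷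
  ( obstruction (5 ∷ 26 ∷ []) (inj₁ 1F) (inj₂ 1F) (inj₁ 0F ∷ inj₁ 4F ∷ inj₁ 3F ∷ inj₁ 2F ∷ inj₂ 0F ∷ [])
  ∷ obstruction (9 ∷ 26 ∷ []) (inj₁ 4F) (inj₂ 1F) (inj₁ 0F ∷ inj₁ 1F ∷ inj₁ 2F ∷ inj₁ 3F ∷ inj₂ 0F ∷ [])
  ∷ obstruction (20 ∷ 26 ∷ []) (inj₁ 3F) (inj₂ 1F) (inj₁ 0F ∷ inj₁ 1F ∷ inj₁ 2F ∷ inj₂ 0F ∷ inj₁ 4F ∷ [])
  ∷ obstruction (11 ∷ 21 ∷ 26 ∷ []) (inj₁ 0F) (inj₂ 0F) (inj₁ 1F ∷ inj₁ 2F ∷ inj₂ 1F ∷ inj₁ 4F ∷ inj₂ 2F ∷ [])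
  ∷ obstruction (11 ∷ 23 ∷ 26 ∷ []) (inj₁ 1F) (inj₂ 2F) (inj₁ 0F ∷ inj₂ 0F ∷ inj₁ 3F ∷ inj₁ 2F ∷ inj₂ 1F ∷ [])
  ∷ obstruction (13 ∷ 13 ∷ 26 ∷ []) (inj₁ 2F) (inj₂ 0F) (inj₁ 0F ∷ inj₁ 1F ∷ inj₂ 2F ∷ inj₁ 3F ∷ inj₂ 1F ∷ [])
  ∷ obstruction (13 ∷ 15 ∷ 26 ∷ []) (inj₁ 2F) (inj₂ 1F) (inj₁ 0F ∷ inj₁ 1F ∷ inj₂ 2F ∷ inj₁ 3F ∷ inj₂ 0F ∷ [])
  ∷ obstruction (13 ∷ 21 ∷ 26 ∷ []) (inj₁ 0F) (inj₂ 0F) (inj₁ 1F ∷ inj₁ 2F ∷ inj₂ 1F ∷ inj₁ 4F ∷ inj₂ 2F ∷ [])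
  ∷ obstruction (13 ∷ 22 ∷ 26 ∷ []) (inj₁ 1F) (inj₂ 1F) (inj₁ 0F ∷ inj₁ 1F ∷ inj₂ 2F ∷ inj₁ 3F ∷ inj₂ 0F ∷ [])
  ∷ obstruction (13 ∷ 23 ∷ 26 ∷ []) (inj₁ 0F) (inj₂ 1F) (inj₁ 0F ∷ inj₁ 1F ∷ inj₂ 2F ∷ inj₁ 3F ∷ inj₂ 0F ∷ [])
  ∷ obstruction (26 ∷ 26 ∷ 13 ∷ []) (inj₁ 4F) (inj₂ 0F) (inj₁ 0F ∷ inj₁ 1F ∷ inj₂ 1F ∷ inj₁ 3F ∷ inj₂ 2F ∷ [])
  ∷ obstruction (15 ∷ 21 ∷ 26 ∷ []) (inj₁ 0F) (inj₂ 0F) (inj₁ 1F ∷ inj₁ 2F ∷ inj₂ 1F ∷ inj₁ 4F ∷ inj₂ 2F ∷ [])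
  ∷ obstruction (15 ∷ 22 ∷ 26 ∷ []) (inj₁ 1F) (inj₂ 2F) (inj₁ 0F ∷ inj₁ 4F ∷ inj₂ 1F ∷ inj₁ 2F ∷ inj₂ 0F ∷ [])
  ∷ obstruction (21 ∷ 21 ∷ 26 ∷ []) (inj₁ 0F) (inj₂ 0F) (inj₁ 1F ∷ inj₁ 2F ∷ inj₂ 1F ∷ inj₁ 4F ∷ inj₂ 2F ∷ [])
  ∷ obstruction (21 ∷ 23 ∷ 26 ∷ []) (inj₁ 0F) (inj₂ 1F) (inj₁ 1F ∷ inj₁ 2F ∷ inj₂ 0F ∷ inj₁ 4F ∷ inj₂ 2F ∷ [])
  ∷ obstruction (26 ∷ 26 ∷ 21 ∷ []) (inj₁ 3F) (inj₂ 0F) (inj₁ 1F ∷ inj₁ 2F ∷ inj₂ 2F ∷ inj₁ 4F ∷ inj₂ 1F ∷ [])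
  ∷ []) ∷
  ( obstruction (5 ∷ 27 ∷ []) (inj₁ 1F) (inj₂ 1F) (inj₁ 0F ∷ inj₁ 4F ∷ inj₁ 3F ∷ inj₁ 2F ∷ inj₂ 0F ∷ [])
  ∷ obstruction (9 ∷ 27 ∷ []) (inj₁ 4F) (inj₂ 1F) (inj₁ 0F ∷ inj₁ 1F ∷ inj₁ 2F ∷ inj₁ 3F ∷ inj₂ 0F ∷ [])
  ∷ obstruction (18 ∷ 27 ∷ []) (inj₁ 0F) (inj₂ 1F) (inj₁ 1F ∷ inj₁ 2F ∷ inj₁ 3F ∷ inj₁ 4F ∷ inj₂ 0F ∷ [])
  ∷ obstruction (20 ∷ 27 ∷ []) (inj₁ 0F) (inj₂ 1F) (inj₁ 0F ∷ inj₁ 1F ∷ inj₁ 2F ∷ inj₂ 0F ∷ inj₁ 4F ∷ [])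
  ∷ obstruction (11 ∷ 21 ∷ 27 ∷ []) (inj₁ 0F) (inj₂ 0F) (inj₁ 1F ∷ inj₁ 2F ∷ inj₂ 1F ∷ inj₁ 4F ∷ inj₂ 2F ∷ [])
  ∷ obstruction (11 ∷ 22 ∷ 27 ∷ []) (inj₁ 0F) (inj₂ 2F) (inj₁ 1F ∷ inj₂ 0F ∷ inj₁ 3F ∷ inj₁ 4F ∷ inj₂ 1F ∷ [])
  ∷ obstruction (11 ∷ 23 ∷ 27 ∷ []) (inj₁ 0F) (inj₂ 2F) (inj₁ 1F ∷ inj₂ 0F ∷ inj₁ 3F ∷ inj₁ 4F ∷ inj₂ 1F ∷ [])
  ∷ obstruction (13 ∷ 21 ∷ 27 ∷ []) (inj₁ 0F) (inj₂ 0F) (inj₁ 1F ∷ inj₁ 2F ∷ inj₂ 1F ∷ inj₁ 4F ∷ inj₂ 2F ∷ [])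
  ∷ obstruction (13 ∷ 22 ∷ 27 ∷ []) (inj₁ 0F) (inj₂ 2F) (inj₁ 0F ∷ inj₁ 4F ∷ inj₂ 1F ∷ inj₁ 2F ∷ inj₂ 0F ∷ [])
  ∷ obstruction (13 ∷ 26 ∷ 27 ∷ []) (inj₁ 4F) (inj₂ 2F) (inj₁ 0F ∷ inj₁ 1F ∷ inj₂ 1F ∷ inj₁ 3F ∷ inj₂ 0F ∷ [])
  ∷ obstruction (15 ∷ 21 ∷ 27 ∷ []) (inj₁ 0F) (inj₂ 0F) (inj₁ 1F ∷ inj₁ 2F ∷ inj₂ 1F ∷ inj₁ 4F ∷ inj₂ 2F ∷ [])
  ∷ obstruction (15 ∷ 22 ∷ 27 ∷ []) (inj₁ 0F) (inj₂ 2F) (inj₁ 0F ∷ inj₁ 4F ∷ inj₂ 1F ∷ inj₁ 2F ∷ inj₂ 0F ∷ [])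
  ∷ obstruction (15 ∷ 23 ∷ 27 ∷ []) (inj₁ 0F) (inj₂ 2F) (inj₁ 1F ∷ inj₂ 0F ∷ inj₁ 3F ∷ inj₁ 4F ∷ inj₂ 1F ∷ [])
  ∷ obstruction (21 ∷ 21 ∷ 27 ∷ []) (inj₁ 0F) (inj₂ 0F) (inj₁ 1F ∷ inj₁ 2F ∷ inj₂ 1F ∷ inj₁ 4F ∷ inj₂ 2F ∷ [])
  ∷ obstruction (21 ∷ 22 ∷ 27 ∷ []) (inj₁ 1F) (inj₂ 1F) (inj₁ 0F ∷ inj₂ 0F ∷ inj₁ 2F ∷ inj₁ 3F ∷ inj₂ 2F ∷ [])
  ∷ obstruction (21 ∷ 23 ∷ 27 ∷ []) (inj₁ 0F) (inj₂ 1F) (inj₁ 1F ∷ inj₁ 2F ∷ inj₂ 0F ∷ inj₁ 4F ∷ inj₂ 2F ∷ [])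
  ∷ obstruction (21 ∷ 26 ∷ 27 ∷ []) (inj₁ 0F) (inj₂ 2F) (inj₁ 1F ∷ inj₁ 2F ∷ inj₂ 0F ∷ inj₁ 4F ∷ inj₂ 1F ∷ [])
  ∷ obstruction (27 ∷ 27 ∷ 21 ∷ []) (inj₁ 0F) (inj₂ 0F) (inj₁ 1F ∷ inj₁ 2F ∷ inj₂ 2F ∷ inj₁ 4F ∷ inj₂ 1F ∷ [])
  ∷ obstruction (22 ∷ 23 ∷ 27 ∷ []) (inj₁ 1F) (inj₂ 0F) (inj₁ 0F ∷ inj₂ 1F ∷ inj₁ 2F ∷ inj₁ 3F ∷ inj₂ 2F ∷ [])
  ∷ obstruction (23 ∷ 23 ∷ 27 ∷ []) (inj₁ 1F) (inj₂ 0F) (inj₁ 0F ∷ inj₂ 1F ∷ inj₁ 2F ∷ inj₁ 3F ∷ inj₂ 2F ∷ [])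
  ∷ obstruction (23 ∷ 26 ∷ 27 ∷ []) (inj₁ 1F) (inj₂ 1F) (inj₁ 0F ∷ inj₂ 0F ∷ inj₁ 2F ∷ inj₁ 3F ∷ inj₂ 2F ∷ [])
  ∷ obstruction (27 ∷ 27 ∷ 23 ∷ []) (inj₁ 1F) (inj₂ 0F) (inj₁ 0F ∷ inj₂ 1F ∷ inj₁ 3F ∷ inj₁ 2F ∷ inj₂ 2F ∷ [])
  ∷ []) ∷
  (obstruction (28 ∷ []) (inj₁ 3F) (inj₂ 0F) (inj₁ 0F ∷ inj₁ 1F ∷ inj₁ 2F ∷ inj₁ 3F ∷ inj₁ 4F ∷ []) ∷ []) ∷
  ( obstruction (9 ∷ 29 ∷ []) (inj₁ 4F) (inj₂ 1F) (inj₁ 0F ∷ inj₁ 1F ∷ inj₁ 2F ∷ inj₁ 3F ∷ inj₂ 0F ∷ [])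
  ∷ obstruction (10 ∷ 29 ∷ []) (inj₁ 2F) (inj₂ 1F) (inj₁ 0F ∷ inj₁ 1F ∷ inj₂ 0F ∷ inj₁ 3F ∷ inj₁ 4F ∷ [])
  ∷ obstruction (18 ∷ 29 ∷ []) (inj₁ 0F) (inj₂ 1F) (inj₁ 1F ∷ inj₁ 2F ∷ inj₁ 3F ∷ inj₁ 4F ∷ inj₂ 0F ∷ [])
  ∷ obstruction (20 ∷ 29 ∷ []) (inj₁ 3F) (inj₂ 1F) (inj₁ 0F ∷ inj₁ 1F ∷ inj₁ 2F ∷ inj₂ 0F ∷ inj₁ 4F ∷ [])
  ∷ obstruction (11 ∷ 21 ∷ 29 ∷ []) (inj₁ 4F) (inj₂ 2F) (inj₁ 0F ∷ inj₂ 0F ∷ inj₁ 3F ∷ inj₁ 2F ∷ inj₂ 1F ∷ [])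
  ∷ obstruction (11 ∷ 22 ∷ 29 ∷ []) (inj₁ 0F) (inj₂ 2F) (inj₁ 1F ∷ inj₂ 0F ∷ inj₁ 3F ∷ inj₁ 4F ∷ inj₂ 1F ∷ [])
  ∷ obstruction (11 ∷ 23 ∷ 29 ∷ []) (inj₁ 0F) (inj₂ 2F) (inj₁ 1F ∷ inj₂ 0F ∷ inj₁ 3F ∷ inj₁ 4F ∷ inj₂ 1F ∷ [])
  ∷ obstruction (11 ∷ 26 ∷ 29 ∷ []) (inj₁ 0F) (inj₂ 0F) (inj₁ 1F ∷ inj₁ 2F ∷ inj₂ 2F ∷ inj₁ 4F ∷ inj₂ 1F ∷ [])
  ∷ obstruction (11 ∷ 27 ∷ 29 ∷ []) (inj₁ 0F) (inj₂ 0F) (inj₁ 1F ∷ inj₁ 2F ∷ inj₂ 2F ∷ inj₁ 4F ∷ inj₂ 1F ∷ [])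
  ∷ obstruction (13 ∷ 22 ∷ 29 ∷ []) (inj₁ 3F) (inj₂ 2F) (inj₁ 0F ∷ inj₁ 4F ∷ inj₂ 1F ∷ inj₁ 2F ∷ inj₂ 0F ∷ [])
  ∷ obstruction (13 ∷ 26 ∷ 29 ∷ []) (inj₁ 0F) (inj₂ 0F) (inj₁ 1F ∷ inj₁ 2F ∷ inj₂ 2F ∷ inj₁ 4F ∷ inj₂ 1F ∷ [])
  ∷ obstruction (13 ∷ 27 ∷ 29 ∷ []) (inj₁ 0F) (inj₂ 0F) (inj₁ 1F ∷ inj₁ 2F ∷ inj₂ 2F ∷ inj₁ 4F ∷ inj₂ 1F ∷ [])
  ∷ obstruction (15 ∷ 22 ∷ 29 ∷ []) (inj₁ 0F) (inj₂ 2F) (inj₁ 1F ∷ inj₂ 0F ∷ inj₁ 3F ∷ inj₁ 4F ∷ inj₂ 1F ∷ [])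
  ∷ obstruction (15 ∷ 23 ∷ 29 ∷ []) (inj₁ 0F) (inj₂ 2F) (inj₁ 1F ∷ inj₂ 0F ∷ inj₁ 3F ∷ inj₁ 4F ∷ inj₂ 1F ∷ [])
  ∷ obstruction (15 ∷ 26 ∷ 29 ∷ []) (inj₁ 0F) (inj₂ 0F) (inj₁ 1F ∷ inj₁ 2F ∷ inj₂ 2F ∷ inj₁ 4F ∷ inj₂ 1F ∷ [])
  ∷ obstruction (15 ∷ 27 ∷ 29 ∷ []) (inj₁ 0F) (inj₂ 0F) (inj₁ 1F ∷ inj₁ 2F ∷ inj₂ 2F ∷ inj₁ 4F ∷ inj₂ 1F ∷ [])
  ∷ obstruction (21 ∷ 26 ∷ 29 ∷ []) (inj₁ 0F) (inj₂ 0F) (inj₁ 0F ∷ inj₁ 1F ∷ inj₂ 1F ∷ inj₁ 3F ∷ inj₂ 2F ∷ [])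
  ∷ obstruction (21 ∷ 27 ∷ 29 ∷ []) (inj₁ 0F) (inj₂ 0F) (inj₁ 1F ∷ inj₁ 2F ∷ inj₂ 2F ∷ inj₁ 4F ∷ inj₂ 1F ∷ [])
  ∷ obstruction (22 ∷ 26 ∷ 29 ∷ []) (inj₁ 1F) (inj₂ 0F) (inj₁ 0F ∷ inj₁ 1F ∷ inj₂ 1F ∷ inj₁ 3F ∷ inj₂ 2F ∷ [])
  ∷ obstruction (23 ∷ 26 ∷ 29 ∷ []) (inj₁ 0F) (inj₂ 0F) (inj₁ 0F ∷ inj₁ 1F ∷ inj₂ 1F ∷ inj₁ 3F ∷ inj₂ 2F ∷ [])
  ∷ obstruction (23 ∷ 27 ∷ 29 ∷ []) (inj₁ 0F) (inj₂ 0F) (inj₁ 1F ∷ inj₁ 2F ∷ inj₂ 2F ∷ inj₁ 4F ∷ inj₂ 1F ∷ [])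
  ∷ obstruction (26 ∷ 26 ∷ 29 ∷ []) (inj₁ 3F) (inj₂ 0F) (inj₁ 1F ∷ inj₁ 2F ∷ inj₂ 2F ∷ inj₁ 4F ∷ inj₂ 1F ∷ [])
  ∷ obstruction (26 ∷ 27 ∷ 29 ∷ []) (inj₁ 0F) (inj₂ 1F) (inj₁ 1F ∷ inj₁ 2F ∷ inj₂ 2F ∷ inj₁ 4F ∷ inj₂ 0F ∷ [])
  ∷ obstruction (29 ∷ 29 ∷ 26 ∷ []) (inj₁ 0F) (inj₂ 0F) (inj₁ 1F ∷ inj₁ 2F ∷ inj₂ 1F ∷ inj₁ 4F ∷ inj₂ 2F ∷ [])
  ∷ obstruction (27 ∷ 27 ∷ 29 ∷ []) (inj₁ 0F) (inj₂ 0F) (inj₁ 1F ∷ inj₁ 2F ∷ inj₂ 2F ∷ inj₁ 4F ∷ inj₂ 1F ∷ [])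
  ∷ obstruction (29 ∷ 29 ∷ 27 ∷ []) (inj₁ 0F) (inj₂ 0F) (inj₁ 1F ∷ inj₁ 2F ∷ inj₂ 1F ∷ inj₁ 4F ∷ inj₂ 2F ∷ [])
  ∷ []) ∷
  ( obstruction (5 ∷ 30 ∷ []) (inj₁ 1F) (inj₂ 1F) (inj₁ 0F ∷ inj₁ 4F ∷ inj₁ 3F ∷ inj₁ 2F ∷ inj₂ 0F ∷ [])
  ∷ obstruction (9 ∷ 30 ∷ []) (inj₁ 2F) (inj₂ 1F) (inj₁ 0F ∷ inj₁ 1F ∷ inj₁ 2F ∷ inj₁ 3F ∷ inj₂ 0F ∷ [])
  ∷ obstruction (10 ∷ 30 ∷ []) (inj₁ 2F) (inj₂ 1F) (inj₁ 0F ∷ inj₁ 1F ∷ inj₂ 0F ∷ inj₁ 3F ∷ inj₁ 4F ∷ [])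
  ∷ obstruction (20 ∷ 30 ∷ []) (inj₁ 3F) (inj₂ 1F) (inj₁ 0F ∷ inj₁ 1F ∷ inj₁ 2F ∷ inj₂ 0F ∷ inj₁ 4F ∷ [])
  ∷ obstruction (11 ∷ 13 ∷ 30 ∷ []) (inj₁ 0F) (inj₂ 0F) (inj₁ 0F ∷ inj₁ 4F ∷ inj₂ 2F ∷ inj₁ 2F ∷ inj₂ 1F ∷ [])
  ∷ obstruction (11 ∷ 15 ∷ 30 ∷ []) (inj₁ 0F) (inj₂ 0F) (inj₁ 0F ∷ inj₁ 4F ∷ inj₂ 2F ∷ inj₁ 2F ∷ inj₂ 1F ∷ [])
  ∷ obstruction (11 ∷ 21 ∷ 30 ∷ []) (inj₁ 1F) (inj₂ 2F) (inj₁ 0F ∷ inj₂ 0F ∷ inj₁ 3F ∷ inj₁ 2F ∷ inj₂ 1F ∷ [])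
  ∷ obstruction (11 ∷ 22 ∷ 30 ∷ []) (inj₁ 2F) (inj₂ 2F) (inj₁ 1F ∷ inj₂ 0F ∷ inj₁ 3F ∷ inj₁ 4F ∷ inj₂ 1F ∷ [])
  ∷ obstruction (11 ∷ 23 ∷ 30 ∷ []) (inj₁ 1F) (inj₂ 2F) (inj₁ 0F ∷ inj₂ 0F ∷ inj₁ 3F ∷ inj₁ 2F ∷ inj₂ 1F ∷ [])
  ∷ obstruction (13 ∷ 13 ∷ 30 ∷ []) (inj₁ 2F) (inj₂ 0F) (inj₁ 0F ∷ inj₁ 1F ∷ inj₂ 2F ∷ inj₁ 3F ∷ inj₂ 1F ∷ [])
  ∷ obstruction (13 ∷ 15 ∷ 30 ∷ []) (inj₁ 1F) (inj₂ 1F) (inj₁ 0F ∷ inj₁ 4F ∷ inj₂ 2F ∷ inj₁ 2F ∷ inj₂ 0F ∷ [])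
  ∷ obstruction (13 ∷ 21 ∷ 30 ∷ []) (inj₁ 0F) (inj₂ 1F) (inj₁ 0F ∷ inj₁ 1F ∷ inj₂ 2F ∷ inj₁ 3F ∷ inj₂ 0F ∷ [])
  ∷ obstruction (13 ∷ 22 ∷ 30 ∷ []) (inj₁ 1F) (inj₂ 1F) (inj₁ 0F ∷ inj₁ 1F ∷ inj₂ 2F ∷ inj₁ 3F ∷ inj₂ 0F ∷ [])
  ∷ obstruction (13 ∷ 23 ∷ 30 ∷ []) (inj₁ 0F) (inj₂ 1F) (inj₁ 0F ∷ inj₁ 1F ∷ inj₂ 2F ∷ inj₁ 3F ∷ inj₂ 0F ∷ [])
  ∷ obstruction (13 ∷ 26 ∷ 30 ∷ []) (inj₁ 1F) (inj₂ 1F) (inj₁ 0F ∷ inj₁ 4F ∷ inj₂ 2F ∷ inj₁ 2F ∷ inj₂ 0F ∷ [])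
  ∷ obstruction (13 ∷ 27 ∷ 30 ∷ []) (inj₁ 0F) (inj₂ 1F) (inj₁ 0F ∷ inj₁ 4F ∷ inj₂ 2F ∷ inj₁ 2F ∷ inj₂ 0F ∷ [])
  ∷ obstruction (13 ∷ 29 ∷ 30 ∷ []) (inj₁ 2F) (inj₂ 0F) (inj₁ 0F ∷ inj₁ 1F ∷ inj₂ 2F ∷ inj₁ 3F ∷ inj₂ 1F ∷ [])
  ∷ obstruction (30 ∷ 30 ∷ 13 ∷ []) (inj₁ 1F) (inj₂ 0F) (inj₁ 0F ∷ inj₁ 4F ∷ inj₂ 1F ∷ inj₁ 2F ∷ inj₂ 2F ∷ [])
  ∷ obstruction (15 ∷ 15 ∷ 30 ∷ []) (inj₁ 1F) (inj₂ 0F) (inj₁ 0F ∷ inj₁ 4F ∷ inj₂ 2F ∷ inj₁ 2F ∷ inj₂ 1F ∷ [])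
  ∷ obstruction (15 ∷ 22 ∷ 30 ∷ []) (inj₁ 1F) (inj₂ 1F) (inj₁ 0F ∷ inj₁ 4F ∷ inj₂ 2F ∷ inj₁ 2F ∷ inj₂ 0F ∷ [])
  ∷ obstruction (15 ∷ 23 ∷ 30 ∷ []) (inj₁ 1F) (inj₂ 1F) (inj₁ 0F ∷ inj₁ 4F ∷ inj₂ 2F ∷ inj₁ 2F ∷ inj₂ 0F ∷ [])
  ∷ obstruction (15 ∷ 26 ∷ 30 ∷ []) (inj₁ 1F) (inj₂ 1F) (inj₁ 0F ∷ inj₁ 4F ∷ inj₂ 2F ∷ inj₁ 2F ∷ inj₂ 0F ∷ [])
  ∷ obstruction (15 ∷ 27 ∷ 30 ∷ []) (inj₁ 0F) (inj₂ 1F) (inj₁ 0F ∷ inj₁ 4F ∷ inj₂ 2F ∷ inj₁ 2F ∷ inj₂ 0F ∷ [])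
  ∷ obstruction (15 ∷ 29 ∷ 30 ∷ []) (inj₁ 2F) (inj₂ 0F) (inj₁ 0F ∷ inj₁ 1F ∷ inj₂ 2F ∷ inj₁ 3F ∷ inj₂ 1F ∷ [])
  ∷ obstruction (30 ∷ 30 ∷ 15 ∷ []) (inj₁ 1F) (inj₂ 0F) (inj₁ 0F ∷ inj₁ 4F ∷ inj₂ 1F ∷ inj₁ 2F ∷ inj₂ 2F ∷ [])
  ∷ obstruction (21 ∷ 26 ∷ 30 ∷ []) (inj₁ 3F) (inj₂ 2F) (inj₁ 1F ∷ inj₁ 2F ∷ inj₂ 0F ∷ inj₁ 4F ∷ inj₂ 1F ∷ [])
  ∷ obstruction (21 ∷ 27 ∷ 30 ∷ []) (inj₁ 1F) (inj₂ 2F) (inj₁ 0F ∷ inj₂ 0F ∷ inj₁ 2F ∷ inj₁ 3F ∷ inj₂ 1F ∷ [])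
  ∷ obstruction (21 ∷ 29 ∷ 30 ∷ []) (inj₁ 0F) (inj₂ 0F) (inj₁ 0F ∷ inj₁ 1F ∷ inj₂ 2F ∷ inj₁ 3F ∷ inj₂ 1F ∷ [])
  ∷ obstruction (22 ∷ 29 ∷ 30 ∷ []) (inj₁ 1F) (inj₂ 0F) (inj₁ 0F ∷ inj₁ 1F ∷ inj₂ 2F ∷ inj₁ 3F ∷ inj₂ 1F ∷ [])
  ∷ obstruction (23 ∷ 27 ∷ 30 ∷ []) (inj₁ 1F) (inj₂ 2F) (inj₁ 0F ∷ inj₂ 0F ∷ inj₁ 2F ∷ inj₁ 3F ∷ inj₂ 1F ∷ [])
  ∷ obstruction (23 ∷ 29 ∷ 30 ∷ []) (inj₁ 0F) (inj₂ 0F) (inj₁ 0F ∷ inj₁ 1F ∷ inj₂ 2F ∷ inj₁ 3F ∷ inj₂ 1F ∷ [])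
  ∷ obstruction (26 ∷ 29 ∷ 30 ∷ []) (inj₁ 2F) (inj₂ 2F) (inj₁ 0F ∷ inj₁ 1F ∷ inj₂ 0F ∷ inj₁ 3F ∷ inj₂ 1F ∷ [])
  ∷ obstruction (27 ∷ 29 ∷ 30 ∷ []) (inj₁ 3F) (inj₂ 2F) (inj₁ 1F ∷ inj₁ 2F ∷ inj₂ 1F ∷ inj₁ 4F ∷ inj₂ 0F ∷ [])
  ∷ obstruction (29 ∷ 29 ∷ 30 ∷ []) (inj₁ 2F) (inj₂ 0F) (inj₁ 0F ∷ inj₁ 1F ∷ inj₂ 2F ∷ inj₁ 3F ∷ inj₂ 1F ∷ [])
  ∷ obstruction (30 ∷ 30 ∷ 29 ∷ []) (inj₁ 2F) (inj₂ 0F) (inj₁ 0F ∷ inj₁ 1F ∷ inj₂ 1F ∷ inj₁ 3F ∷ inj₂ 2F ∷ [])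
  ∷ []) ∷
  ( obstruction (5 ∷ 31 ∷ []) (inj₁ 1F) (inj₂ 1F) (inj₁ 0F ∷ inj₁ 4F ∷ inj₁ 3F ∷ inj₁ 2F ∷ inj₂ 0F ∷ [])
  ∷ obstruction (9 ∷ 31 ∷ []) (inj₁ 4F) (inj₂ 1F) (inj₁ 0F ∷ inj₁ 1F ∷ inj₁ 2F ∷ inj₁ 3F ∷ inj₂ 0F ∷ [])
  ∷ obstruction (10 ∷ 31 ∷ []) (inj₁ 2F) (inj₂ 1F) (inj₁ 0F ∷ inj₁ 1F ∷ inj₂ 0F ∷ inj₁ 3F ∷ inj₁ 4F ∷ [])
  ∷ obstruction (18 ∷ 31 ∷ []) (inj₁ 0F) (inj₂ 1F) (inj₁ 1F ∷ inj₁ 2F ∷ inj₁ 3F ∷ inj₁ 4F ∷ inj₂ 0F ∷ [])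
  ∷ obstruction (20 ∷ 31 ∷ []) (inj₁ 3F) (inj₂ 1F) (inj₁ 0F ∷ inj₁ 1F ∷ inj₁ 2F ∷ inj₂ 0F ∷ inj₁ 4F ∷ [])
  ∷ obstruction (11 ∷ 21 ∷ 31 ∷ []) (inj₁ 1F) (inj₂ 2F) (inj₁ 0F ∷ inj₂ 0F ∷ inj₁ 3F ∷ inj₁ 2F ∷ inj₂ 1F ∷ [])
  ∷ obstruction (11 ∷ 22 ∷ 31 ∷ []) (inj₁ 0F) (inj₂ 2F) (inj₁ 1F ∷ inj₂ 0F ∷ inj₁ 3F ∷ inj₁ 4F ∷ inj₂ 1F ∷ [])
  ∷ obstruction (11 ∷ 23 ∷ 31 ∷ []) (inj₁ 0F) (inj₂ 2F) (inj₁ 1F ∷ inj₂ 0F ∷ inj₁ 3F ∷ inj₁ 4F ∷ inj₂ 1F ∷ [])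
  ∷ obstruction (13 ∷ 22 ∷ 31 ∷ []) (inj₁ 1F) (inj₂ 2F) (inj₁ 0F ∷ inj₁ 4F ∷ inj₂ 1F ∷ inj₁ 2F ∷ inj₂ 0F ∷ [])
  ∷ obstruction (13 ∷ 26 ∷ 31 ∷ []) (inj₁ 2F) (inj₂ 2F) (inj₁ 0F ∷ inj₁ 1F ∷ inj₂ 1F ∷ inj₁ 3F ∷ inj₂ 0F ∷ [])
  ∷ obstruction (13 ∷ 30 ∷ 31 ∷ []) (inj₁ 1F) (inj₂ 2F) (inj₁ 0F ∷ inj₁ 4F ∷ inj₂ 1F ∷ inj₁ 2F ∷ inj₂ 0F ∷ [])
  ∷ obstruction (15 ∷ 22 ∷ 31 ∷ []) (inj₁ 0F) (inj₂ 2F) (inj₁ 1F ∷ inj₂ 0F ∷ inj₁ 3F ∷ inj₁ 4F ∷ inj₂ 1F ∷ [])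
  ∷ obstruction (15 ∷ 23 ∷ 31 ∷ []) (inj₁ 0F) (inj₂ 2F) (inj₁ 1F ∷ inj₂ 0F ∷ inj₁ 3F ∷ inj₁ 4F ∷ inj₂ 1F ∷ [])
  ∷ obstruction (15 ∷ 30 ∷ 31 ∷ []) (inj₁ 1F) (inj₂ 2F) (inj₁ 0F ∷ inj₁ 4F ∷ inj₂ 1F ∷ inj₁ 2F ∷ inj₂ 0F ∷ [])
  ∷ obstruction (21 ∷ 26 ∷ 31 ∷ []) (inj₁ 0F) (inj₂ 2F) (inj₁ 1F ∷ inj₁ 2F ∷ inj₂ 0F ∷ inj₁ 4F ∷ inj₂ 1F ∷ [])
  ∷ obstruction (21 ∷ 27 ∷ 31 ∷ []) (inj₁ 0F) (inj₂ 2F) (inj₁ 1F ∷ inj₁ 2F ∷ inj₂ 0F ∷ inj₁ 4F ∷ inj₂ 1F ∷ [])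
  ∷ obstruction (23 ∷ 27 ∷ 31 ∷ []) (inj₁ 1F) (inj₂ 2F) (inj₁ 0F ∷ inj₂ 0F ∷ inj₁ 2F ∷ inj₁ 3F ∷ inj₂ 1F ∷ [])
  ∷ obstruction (26 ∷ 29 ∷ 31 ∷ []) (inj₁ 0F) (inj₂ 2F) (inj₁ 1F ∷ inj₁ 2F ∷ inj₂ 1F ∷ inj₁ 4F ∷ inj₂ 0F ∷ [])
  ∷ obstruction (27 ∷ 29 ∷ 31 ∷ []) (inj₁ 0F) (inj₂ 2F) (inj₁ 1F ∷ inj₁ 2F ∷ inj₂ 1F ∷ inj₁ 4F ∷ inj₂ 0F ∷ [])
  ∷ obstruction (29 ∷ 30 ∷ 31 ∷ []) (inj₁ 2F) (inj₂ 2F) (inj₁ 0F ∷ inj₁ 1F ∷ inj₂ 1F ∷ inj₁ 3F ∷ inj₂ 0F ∷ [])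
  ∷ []) ∷
  []

obstructions-valid : All (All Valid) obstructions
obstructions-valid = toWitness {a? = All.all? (All.all? valid?) obstructions} _

-- shapeₖ stands for family (k) of the statement, its arguments being the codes
-- of the neighbourhood classes, in the order listed there.
data Shape : Set where
  shape₁               : (a b : ℕ) → Shape
  shape₂ shape₃ shape₄ : (a b c : ℕ) → Shape
  shape₅               : (a b c d : ℕ) → Shape
  shape₆               : (a b c d e : ℕ) → Shape

Block : Set
Block = ℕ × Nbhd

blocks : Shape → Block × List Block
blocks (shape₁ a b)       = (a , N-rtu)  , (b , N-stuv) ∷ []
blocks (shape₂ a b c)     = (a , N-rtu)  , (b , N-suv) ∷ (c , N-rsu) ∷ []
blocks (shape₃ a b c)     = (a , N-rsTu) , (b , N-stuv) ∷ (c , N-rtv) ∷ []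
blocks (shape₄ a b c)     = (a , N-rt)   , (b , N-ru) ∷ (c , N-rtu) ∷ []
blocks (shape₅ a b c d)   = (a , N-rt)   , (b , N-rtu) ∷ (c , N-rtv) ∷ (d , N-rtuv) ∷ []
blocks (shape₆ a b c d e) = (a , N-rtu)  , (b , N-rtv) ∷ (c , N-rsTu) ∷ (d , N-rtuv) ∷ (e , N-rstuv) ∷ []

exactlyOnce : Shape → List ℕ
exactlyOnce (shape₁ a b)   = a ∷ b ∷ []
exactlyOnce (shape₂ a b _) = a ∷ b ∷ []
exactlyOnce (shape₃ a b _) = a ∷ b ∷ []
exactlyOnce _              = []

layout : ∀ {A : Set} → (ℕ → Nbhd → List A) → Block → List Block → List A
layout F (c , N) []       = F c N
layout F (c , N) (b ∷ bs) = F c N ++ layout F b bs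

exceptional : ∀ (κ : ℕ → ℕ) s → All (λ c → κ c ≡ 1) (exactlyOnce s) →
  Exceptional (uncurry (layout (λ c N → replicate (κ c) N)) (blocks s))
exceptional κ (shape₁ a b)       (κa ∷ κb ∷ []) rewrite κa | κb = ex1
exceptional κ (shape₂ a b c)     (κa ∷ κb ∷ []) rewrite κa | κb = ex2 (κ c)
exceptional κ (shape₃ a b c)     (κa ∷ κb ∷ []) rewrite κa | κb = ex3 (κ c)
exceptional κ (shape₄ a b c)     []             = ex4 (κ a) (κ b) (κ c)
exceptional κ (shape₅ a b c d)   []             = ex5 (κ a) (κ b) (κ c) (κ d)
exceptional κ (shape₆ a b c d e) []             = ex6 (κ a) (κ b) (κ c) (κ d) (κ e)

-- The codes of a family are taken with respect to the original cycle, and its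
-- neighbourhoods with respect to the cycle relabelled by a dihedral symmetry.
record Family : Set where
  constructor family
  field
    reflected : Bool
    offset    : Fin 5
    shape     : Shape

  relabelling : Fin 5 → Fin 5
  relabelling = dihedral reflected offset

  allBlocks : List Block
  allBlocks = proj₁ (blocks shape) ∷ proj₂ (blocks shape)

  familyCodes : List ℕ
  familyCodes = map proj₁ allBlocks

open Family

WellFormed : Family → Set
WellFormed F =
  All (λ (c , N) → ∀ i → decode c (relabelling F i) ≡ N i) (allBlocks F) × Unique (familyCodes F)

wellFormed? : ∀ F → Dec (WellFormed F)
wellFormed? F =
  All.all? (λ (c , N) → all? λ i → decode c (relabelling F i) Bool.≟ N i) (allBlocks F)
  ×-dec AllPairs.allPairs? (λ c d → ¬? (c ≟ℕ d)) (familyCodes F)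

Fits : Profile → Family → Set
Fits q F = (∀ c → entry q c ≢ 0 → c ∈ familyCodes F) × All (λ c → entry q c ≡ 1) (exactlyOnce (shape F))

fits : Profile → Family → Bool
fits q F = all (λ c → entry q c ≡ᵇ 1) (exactlyOnce (shape F)) ∧ supportedBy (familyCodes F) 0 q

fits-sound : ∀ q F → T (fits q F) → Fits q F
fits-sound q F t =
  let once , supported = Equivalence.to (T-∧ {all (λ c → entry q c ≡ᵇ 1) (exactlyOnce (shape F))}) t
  in supportedBy-sound (familyCodes F) 0 q supported , All.map (≡ᵇ⇒≡ _ 1) (all-sound _ _ once)

families : List Family
families =
  family false 0F (shape₆ 13 21 15 29 31) ∷
  family false 1F (shape₆ 26 11 30 27 31) ∷
  family true  4F (shape₆ 22 21 30 23 31) ∷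
  family false 3F (shape₆ 11 13 27 15 31) ∷
  family true  1F (shape₆ 26 22 27 30 31) ∷
  family false 2F (shape₆ 21 22 29 23 31) ∷
  family true  0F (shape₆ 13 11 29 15 31) ∷
  family true  2F (shape₆ 21 13 23 29 31) ∷
  family true  3F (shape₆ 11 26 15 27 31) ∷
  family false 4F (shape₆ 22 26 23 30 31) ∷
  family false 0F (shape₅ 5 13 21 29) ∷
  family true  0F (shape₅ 9 13 11 15) ∷
  family false 1F (shape₅ 10 26 11 27) ∷
  family true  1F (shape₅ 18 26 22 30) ∷
  family false 2F (shape₅ 20 21 22 23) ∷
  family false 0F (shape₄ 5 9 13) ∷
  family false 1F (shape₄ 10 18 26) ∷
  family false 2F (shape₄ 20 5 21) ∷
  family false 3F (shape₄ 9 10 11) ∷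
  family false 4F (shape₄ 18 20 22) ∷
  family false 0F (shape₂ 13 26 11) ∷
  family false 0F (shape₃ 15 30 21) ∷
  family true  0F (shape₂ 13 22 21) ∷
  family true  0F (shape₃ 29 30 11) ∷
  family false 1F (shape₂ 26 21 22) ∷
  family true  1F (shape₃ 27 29 22) ∷
  family false 2F (shape₂ 21 11 13) ∷
  family true  2F (shape₃ 23 27 13) ∷
  family false 3F (shape₂ 11 22 26) ∷
  family true  3F (shape₃ 15 23 26) ∷
  family false 0F (shape₁ 13 30) ∷
  family false 1F (shape₁ 26 29) ∷
  family false 2F (shape₁ 21 27) ∷
  family false 3F (shape₁ 11 23) ∷
  family false 4F (shape₁ 22 15) ∷
  []

families-wellFormed : All WellFormed families
families-wellFormed = toWitness {a? = All.all? wellFormed? families} _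

-- The search over profiles

Absent : Profile → List Obstruction → Set
Absent q = All (λ o → ¬ Present q (codes o))

obstructed : List Obstruction → Profile → Bool
obstructed os q = any (λ o → present q (codes o)) os

obstructed-sound : ∀ os q → T (obstructed os q) → Any (λ o → Present q (codes o)) os
obstructed-sound os q t = Any.map (λ {o} → present-sound q (codes o)) (any⁻ _ _ t)

fitsSomeFamily : Profile → Bool
fitsSomeFamily q = any (fits q) families

fitsSomeFamily-sound : ∀ q → T (fitsSomeFamily q) → Any (Fits q) families
fitsSomeFamily-sound q t = Any.map (λ {F} → fits-sound q F) (any⁻ _ _ t)

-- The entries are filled in one code at a time, and the group of obstructions
-- whose largest code is the current one is checked right away.
mutual
  allCompletionsFit : List (List Obstruction) → Profile → ℕ → Bool
  allCompletionsFit _        q zero    = fitsSomeFamily q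
  allCompletionsFit []       q (suc r) = false
  allCompletionsFit (g ∷ gs) q (suc r) =
    extensionFits g gs q r 0 ∧ extensionFits g gs q r 1 ∧ extensionFits g gs q r 2

  extensionFits : List Obstruction → List (List Obstruction) → Profile → ℕ → ℕ → Bool
  extensionFits g gs q r k = obstructed g (q ++ k ∷ []) ∨ allCompletionsFit gs (q ++ k ∷ []) r

extensionFits-of : ∀ {g gs q r k} → T (allCompletionsFit (g ∷ gs) q (suc r)) → k ≤ 2 →
  T (extensionFits g gs q r k)
extensionFits-of {g} {gs} {q} {r} fit k≤2 with Equivalence.to (T-∧ {extensionFits g gs q r 0}) fit
... | fit₀ , fit₁₂ with Equivalence.to (T-∧ {extensionFits g gs q r 1}) fit₁₂
...   | fit₁ , fit₂ with k≤2
...     | z≤n           = fit₀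
...     | s≤s z≤n       = fit₁
...     | s≤s (s≤s z≤n) = fit₂

-- stated with _≡ true, not T, so that applying it does not re-run the search
allCompletionsFit-sound : ∀ gs q r → allCompletionsFit gs q r ≡ true → ∀ ext → length ext ≡ r →
  All (_≤ 2) ext → All (Absent (q ++ ext)) gs → Any (Fits (q ++ ext)) families
allCompletionsFit-sound gs q zero fit [] refl [] _ =
  subst (λ p → Any (Fits p) families) (sym (++-identityʳ q)) (fitsSomeFamily-sound q (Equivalence.from T-≡ fit))
allCompletionsFit-sound (g ∷ gs) q (suc r) fit (k ∷ ext) refl (k≤2 ∷ ext≤2) (g-absent ∷ gs-absent)
  with Equivalence.to (T-∨ {obstructed g (q ++ k ∷ [])})
         (extensionFits-of {g} {gs} {q} {r} (Equivalence.from T-≡ fit) k≤2)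
... | inj₁ g-present =
  let found = obstructed-sound g (q ++ k ∷ []) g-present
      absent , present = All.lookupAny g-absent′ found
  in ⊥-elim (absent (Present-++ (q ++ k ∷ []) ext {codes (Any.lookup found)} present))
  where
  g-absent′ : Absent ((q ++ k ∷ []) ++ ext) g
  g-absent′ = subst (λ p → Absent p g) (sym (++-assoc q (k ∷ []) ext)) g-absent
... | inj₂ completed = subst (λ p → Any (Fits p) families) (++-assoc q (k ∷ []) ext)
  (allCompletionsFit-sound gs (q ++ k ∷ []) r (Equivalence.to T-≡ completed) ext refl ext≤2
    (subst (λ p → All (Absent p) gs) (sym (++-assoc q (k ∷ []) ext)) gs-absent))

every-profile-covered : allCompletionsFit obstructions (0 ∷ []) 31 ≡ true
every-profile-covered = refl

layout-Pointwise : ∀ {A B : Set} {R : A → B → Set} {F : ℕ → Nbhd → List A} {F′ : ℕ → Nbhd → List B} b bs →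
  All (λ (c , N) → Pointwise R (F c N) (F′ c N)) (b ∷ bs) → Pointwise R (layout F b bs) (layout F′ b bs)
layout-Pointwise b []        (p ∷ [])  = p
layout-Pointwise b (b′ ∷ bs) (p ∷ ps) = Pointwise.++⁺ p (layout-Pointwise b′ bs ps)

∈-layout⁺ : ∀ {A : Set} {F : ℕ → Nbhd → List A} b bs {c N x} → (c , N) ∈ b ∷ bs → x ∈ F c N → x ∈ layout F b bs
∈-layout⁺ b []        (here refl) x∈ = x∈
∈-layout⁺ b (b′ ∷ bs) (here refl) x∈ = ∈-++⁺ˡ x∈
∈-layout⁺ b (b′ ∷ bs) (there p)   x∈ = ∈-++⁺ʳ _ (∈-layout⁺ b′ bs p x∈)

∈-layout⁻ : ∀ {A : Set} {F : ℕ → Nbhd → List A} b bs {x} → x ∈ layout F b bs →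
  ∃ λ ((c , N) : Block) → (c , N) ∈ b ∷ bs × x ∈ F c N
∈-layout⁻ b [] x∈ = b , here refl , x∈
∈-layout⁻ {F = F} (c , N) (b′ ∷ bs) x∈ with ∈-++⁻ (F c N) x∈
... | inj₁ x∈F = (c , N) , here refl , x∈F
... | inj₂ x∈rest with ∈-layout⁻ b′ bs x∈rest
...   | blk , blk∈ , x∈F = blk , there blk∈ , x∈F

layout-unique : ∀ {A : Set} {F : ℕ → Nbhd → List A} (key : A → ℕ) b bs → Unique (map proj₁ (b ∷ bs)) →
  (∀ c N → Unique (F c N)) → (∀ {c N x} → x ∈ F c N → key x ≡ c) → Unique (layout F b bs)
layout-unique key (c , N) [] _ unique _ = unique c N
layout-unique {F = F} key (c , N) (b ∷ bs) (c∉ ∷ codes-unique) unique keyed =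
  Unique.++⁺ (unique c N) (layout-unique key b bs codes-unique unique keyed) disjoint
  where
  disjoint : Disjoint (F c N) (layout F b bs)
  disjoint (x∈F , x∈rest) with ∈-layout⁻ b bs x∈rest
  ... | (d , M) , dM∈ , x∈F′ = All.lookup c∉ (∈-map⁺ proj₁ dM∈) (trans (sym (keyed x∈F)) (keyed x∈F′))

All⇒Pointwise-replicate : ∀ {A B : Set} {R : A → B → Set} {N : B} {ys : List A} →
  All (λ y → R y N) ys → Pointwise R ys (replicate (length ys) N)
All⇒Pointwise-replicate []       = []
All⇒Pointwise-replicate (r ∷ rs) = r ∷ All⇒Pointwise-replicate rs

OffCycle : ∀ {n} → (Fin 5 → Fin n) → Fin n → Set
OffCycle h x = ∀ i → h i ≢ x

OffCycle-∘ : ∀ {n} {f : Fin 5 → Fin n} {σ : Fin 5 → Fin 5} → (∀ j → ∃ λ i → σ i ≡ j) →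
  ∀ {x} → OffCycle (f ∘ σ) x → OffCycle f x
OffCycle-∘ σ-onto x-off j with σ-onto j
... | i , refl = x-off i

module ExceptionalEmbedding {n} (G : Graph n) {h : Fin 5 → Fin n} (h-cycle : InducesCycle 4 (adj G) h)
  (independent : ∀ {x y} → OffCycle h x → OffCycle h y → adj G x y ≡ false)
  (L : List Nbhd) {xs : Fin (length L) → Fin n} (xs-injective : ∀ {k l} → xs k ≡ xs l → k ≡ l)
  (xs-off : ∀ k → OffCycle h (xs k)) (xs-sees : ∀ k → Sees G h (xs k) (lookup L k)) where

  embed : ExcV L → Fin n
  embed (inj₁ i) = h i
  embed (inj₂ k) = xs k

  embed-injective : ∀ {a b} → embed a ≡ embed b → a ≡ b
  embed-injective {inj₁ i} {inj₁ j} e = cong inj₁ (inducesCycle⇒injective (adj G) h C₅-separated h-cycle i j e)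
  embed-injective {inj₁ i} {inj₂ k} e = ⊥-elim (xs-off k i e)
  embed-injective {inj₂ k} {inj₁ i} e = ⊥-elim (xs-off k i (sym e))
  embed-injective {inj₂ k} {inj₂ l} e = cong inj₂ (xs-injective e)

  embed-adj : ∀ a b → adj G (embed a) (embed b) ≡ excAdj L a b
  embed-adj (inj₁ i) (inj₁ j) = h-cycle i j
  embed-adj (inj₁ i) (inj₂ k) = trans (adj-sym G (h i) (xs k)) (xs-sees k i)
  embed-adj (inj₂ k) (inj₁ i) = xs-sees k i
  embed-adj (inj₂ k) (inj₂ l) = independent (xs-off k) (xs-off l)

  isomorphism : (∀ x → ∃ λ a → embed a ≡ x) → IsoToExc G L
  isomorphism onto =
    mk↔ₛ′ to embed (λ a → embed-injective (embed-to (embed a))) embed-to , λ x y →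
      trans (cong₂ (adj G) (sym (embed-to x)) (sym (embed-to y))) (embed-adj (to x) (to y))
    where
    to : Fin n → ExcV L
    to = proj₁ ∘ onto
    embed-to : ∀ x → embed (to x) ≡ x
    embed-to = proj₂ ∘ onto

module ExceptionalIsomorphism {n} (G : Graph n) {h : Fin 5 → Fin n} (h-cycle : InducesCycle 4 (adj G) h)
  (independent : ∀ {x y} → OffCycle h x → OffCycle h y → adj G x y ≡ false)
  {ys : List (Fin n)} {L : List Nbhd} (match : Pointwise (λ y N → OffCycle h y × Sees G h y N) ys L)
  (ys-unique : Unique ys) (ys-complete : ∀ {x} → OffCycle h x → x ∈ ys) where

  |ys|≡|L| : length ys ≡ length L
  |ys|≡|L| = Pointwise-length match

  xs : Fin (length L) → Fin n
  xs = lookup ys ∘ cast (sym |ys|≡|L|)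

  matched : ∀ k → OffCycle h (xs k) × Sees G h (xs k) (lookup L k)
  matched = lookup-cast (Pointwise.symmetric (λ r → r) match) (sym |ys|≡|L|)

  open ExceptionalEmbedding G h-cycle independent L {xs}
    (λ e → cast-injective (sym |ys|≡|L|) (lookup-injective ys-unique _ _ e))
    (proj₁ ∘ matched) (proj₂ ∘ matched)

  onto : ∀ x → ∃ λ a → embed a ≡ x
  onto x with any? (λ i → h i ≟ x)
  ... | yes (i , hi≡x) = inj₁ i , hi≡x
  ... | no  off        = inj₂ (cast |ys|≡|L| (Any.index x∈ys)) ,
    trans (cong (lookup ys) (cast-involutive (sym |ys|≡|L|) |ys|≡|L| (Any.index x∈ys))) (sym (lookup-index x∈ys))
    where
    x∈ys : x ∈ ys
    x∈ys = ys-complete λ i e → off (i , e)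

  isomorphic : IsoToExc G L
  isomorphic = isomorphism onto

-- Graphs with an induced C₅ whose contractions are C₅-free

module InducedC₅ {n} (G : Graph n) {f : Fin 5 → Fin n} (f-cycle : InducesCycle 4 (adj G) f)
  (contractions-C5Free : ∀ u v → adj G u v ≡ true → C5Free (contract G u v)) where

  -- contracting an edge between two vertices off the cycle keeps the cycle
  off-cycle-independent : ∀ {x y} → OffCycle f x → OffCycle f y → adj G x y ≡ false
  off-cycle-independent {x} {y} x-off y-off with adj G x y in xy
  ... | false = refl
  ... | true  = ⊥-elim (contractions-C5Free x y xy (inducedC₅ (contract G x y) (λ i → f i , y-off i)
        λ i j → trans (Contract-away _≟_ (adj G) (adj-irrefl G) (x-off i) (x-off j)) (f-cycle i j)))

  no-contraction-C₅ : ∀ L {xs : Fin (length L) → Fin n} → (∀ {k l} → xs k ≡ xs l → k ≡ l) →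
    (∀ k → OffCycle f (xs k)) → (∀ k → Sees G f (xs k) (lookup L k)) → ∀ {a b w} → ¬ ContractsToC₅ L a b w
  no-contraction-C₅ L {xs} xs-injective xs-off xs-sees {a} {b} {w} (ab , w≢b , w-cycle) =
    contractions-C5Free (embed a) (embed b) (trans (embed-adj a b) ab)
      (inducedC₅ (contract G (embed a) (embed b)) (λ i → embed (w i) , λ e → w≢b i (embed-injective e))
        λ i j → trans (Contract-embedding (≟-ExcV L) _≟_ {excAdj L} {adj G} {embed} embed-injective embed-adj
                                          a b (w i) (w j))
                      (w-cycle i j))
    where open ExceptionalEmbedding G f-cycle off-cycle-independent L xs-injective xs-off xs-sees

  type : Fin n → Nbhd
  type x i = adj G x (f i)

  code : Fin n → ℕ
  code x = encode (type x)

  offCycleWithCode? : ∀ c → Decidable (λ x → OffCycle f x × code x ≡ c)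
  offCycleWithCode? c x = all? (λ i → ¬? (f i ≟ x)) ×-dec (code x ≟ℕ c)

  vertices : ℕ → List (Fin n)
  vertices c = filter (offCycleWithCode? c) (allFin n)

  count : ℕ → ℕ
  count c = length (vertices c)

  vertices-unique : ∀ c → Unique (vertices c)
  vertices-unique c = Unique.filter⁺ (offCycleWithCode? c) (Unique.allFin⁺ n)

  ∈-vertices⁻ : ∀ {c x} → x ∈ vertices c → OffCycle f x × code x ≡ c
  ∈-vertices⁻ {c} x∈ = proj₂ (∈-filter⁻ (offCycleWithCode? c) {xs = allFin n} x∈)

  ∈-vertices⁺ : ∀ {x} → OffCycle f x → x ∈ vertices (code x)
  ∈-vertices⁺ {x} x-off = ∈-filter⁺ (offCycleWithCode? (code x)) (∈-allFin x) (x-off , refl)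

  ∈-vertices⇒sees : ∀ {c x} → x ∈ vertices c → Sees G f x (decode c)
  ∈-vertices⇒sees {c} {x} x∈ i =
    trans (sym (decode-encode (type x) i)) (cong (λ d → decode d i) (proj₂ (∈-vertices⁻ x∈)))

  profile : Profile
  profile = applyUpTo (λ c → count c ⊓ 2) 32

  counted : ∀ {x} → OffCycle f x → entry profile (code x) ≢ 0
  counted {x} x-off none = length⊓2≢0 (∈-vertices⁺ x-off)
    (trans (sym (entry-applyUpTo (λ c → count c ⊓ 2) (encode-< (type x)))) none)

  profile-avoids : All (Absent profile) obstructions
  profile-avoids = All.map (All.map absent) obstructions-valid
    where
    absent : ∀ {o} → Valid o → ¬ Present profile (codes o)
    absent {obstruction cs a b w} valid present =
      no-contraction-C₅ (map decode cs) {xs} (λ e → cast-injective |L|≡|cs| (r-injective _ _ e))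
        (λ k → proj₁ (∈-vertices⁻ (r-∈ (cast |L|≡|cs| k))))
        (λ k i → trans (∈-vertices⇒sees (r-∈ (cast |L|≡|cs| k)) i)
                       (sym (cong (λ N → N i) (lookup-map decode cs k))))
        valid
      where
      |L|≡|cs| : length (map decode cs) ≡ length cs
      |L|≡|cs| = length-map decode cs
      bound : ∀ c → occurrences c cs ≤ count c
      bound c = ≤-trans (present c) (≤-trans (entry-applyUpTo-≤ (λ c → count c ⊓ 2) 32 c) (m⊓n≤m (count c) 2))
      reps : Σ (Fin (length cs) → Fin n) λ r → (∀ k l → r k ≡ r l → k ≡ l) × (∀ k → r k ∈ vertices (lookup cs k))
      reps = representatives code vertices vertices-unique (λ x∈ → proj₂ (∈-vertices⁻ x∈)) cs bound
      r-injective : ∀ k l → proj₁ reps k ≡ proj₁ reps l → k ≡ l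
      r-injective = proj₁ (proj₂ reps)
      r-∈ : ∀ k → proj₁ reps k ∈ vertices (lookup cs k)
      r-∈ = proj₂ (proj₂ reps)
      xs : Fin (length (map decode cs)) → Fin n
      xs = proj₁ reps ∘ cast |L|≡|cs|

  module _ (no-isolated : NoIsolated G) where

    vertices-zero-empty : ∀ {x} → x ∉ vertices 0
    vertices-zero-empty {x} x∈ with no-isolated x
    ... | y , xy with any? (λ i → f i ≟ y)
    ...   | yes (i , refl) = contradiction (trans (sym xy) (trans (∈-vertices⇒sees x∈ i) (decode-zero i))) λ ()
    ...   | no  y-on       =
      contradiction (trans (sym xy) (off-cycle-independent (proj₁ (∈-vertices⁻ x∈)) λ i e → y-on (i , e))) λ ()

    profile-fits : Any (Fits profile) families
    profile-fits = subst (λ q → Any (Fits q) families) (sym profile≡)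
      (allCompletionsFit-sound obstructions (0 ∷ []) 31 every-profile-covered rest
        (length-applyUpTo (λ c → count (suc c) ⊓ 2) 31)
        (applyUpTo⁺₂ (λ c → count (suc c) ⊓ 2) 31 λ c → m⊓n≤n (count (suc c)) 2)
        (subst (λ p → All (Absent p) obstructions) profile≡ profile-avoids))
      where
      rest : Profile
      rest = applyUpTo (λ c → count (suc c) ⊓ 2) 31
      profile≡ : profile ≡ (0 ∷ []) ++ rest
      profile≡ = cong (λ k → k ⊓ 2 ∷ rest) (length-∅ vertices-zero-empty)

  module Isomorphism (F : Family) (wf : WellFormed F) (fits : Fits profile F) where

    σ : Fin 5 → Fin 5
    σ = relabelling F

    h : Fin 5 → Fin n
    h = f ∘ σ

    h-cycle : InducesCycle 4 (adj G) h
    h-cycle = inducesCycle-∘ (adj G) f (dihedral-preserves (reflected F) (offset F)) f-cycle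

    off-h⇒off-f : ∀ {x} → OffCycle h x → OffCycle f x
    off-h⇒off-f = OffCycle-∘ (dihedral-surjective (reflected F) (offset F))

    b : Block
    b = proj₁ (blocks (shape F))

    bs : List Block
    bs = proj₂ (blocks (shape F))

    ys : List (Fin n)
    ys = layout (λ c _ → vertices c) b bs

    L : List Nbhd
    L = layout (λ c N → replicate (count c) N) b bs

    match : Pointwise (λ y N → OffCycle h y × Sees G h y N) ys L
    match = layout-Pointwise b bs (All.map block (proj₁ wf))
      where
      block : ∀ {(c , N) : Block} → (∀ i → decode c (σ i) ≡ N i) →
        Pointwise (λ y N → OffCycle h y × Sees G h y N) (vertices c) (replicate (count c) N)
      block decoded = All⇒Pointwise-replicate (All.tabulate λ y∈ →
        (λ i → proj₁ (∈-vertices⁻ y∈) (σ i)) , λ i → trans (∈-vertices⇒sees y∈ (σ i)) (decoded i))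

    ys-unique : Unique ys
    ys-unique = layout-unique code b bs (proj₂ wf)
      (λ c _ → vertices-unique c) (λ x∈ → proj₂ (∈-vertices⁻ x∈))

    ys-complete : ∀ {x} → OffCycle h x → x ∈ ys
    ys-complete {x} x-off with ∈-map⁻ proj₁ (proj₁ fits (code x) (counted (off-h⇒off-f x-off)))
    ... | (c , N) , blk∈ , refl =
      ∈-layout⁺ b bs blk∈ (∈-vertices⁺ (off-h⇒off-f x-off))

    isomorphic : IsoToExc G L
    isomorphic = ExceptionalIsomorphism.isomorphic G h-cycle
      (λ x-off y-off → off-cycle-independent (off-h⇒off-f x-off) (off-h⇒off-f y-off)) match ys-unique ys-complete

    once : All (λ c → count c ≡ 1) (exactlyOnce (shape F))
    once = All.map count≡1 (proj₂ fits)
      where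
      count≡1 : ∀ {c} → entry profile c ≡ 1 → count c ≡ 1
      count≡1 {c} entry≡1 = ⊓2≡1 (trans (sym (entry-applyUpTo-≢0 (λ c → count c ⊓ 2) 32 c
        λ entry≡0 → 1+n≢0 (trans (sym entry≡1) entry≡0))) entry≡1)

  exceptional-structure : NoIsolated G → ∃ λ L → Exceptional L × IsoToExc G L
  exceptional-structure no-isolated = L , exceptional count (shape F) once , isomorphic
    where
    found : Any (Fits profile) families
    found = profile-fits no-isolated
    F : Family
    F = Any.lookup found
    well-formed-fitting : WellFormed F × Fits profile F
    well-formed-fitting = All.lookupAny families-wellFormed found
    open Isomorphism F (proj₁ well-formed-fitting) (proj₂ well-formed-fitting)

theorem36 : (n : ℕ) (G : Graph n) → NoIsolated G → C6Free (adj G)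
    → (∀ (L : List Nbhd) → Exceptional L → ¬ IsoToExc G L)
    → C5Free (adj G) ⇔ (∀ (u v : Fin n) → adj G u v ≡ true → C5Free (contract G u v))
theorem36 n G no-isolated c6 not-exceptional = mk⇔
  (λ c5 u v uv → C₅FreeContraction.contraction-C5Free G c5 c6 uv)
  (λ contractions (f , _ , f-cycle) →
    let L , exc , iso = InducedC₅.exceptional-structure G f-cycle contractions no-isolated
    in not-exceptional L exc iso)
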